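{- For the hard-core model at activity $\lambda=3.1$, WSM holds for the tree $T_{\boldsymbol{D}'}$ but SSM does not hold for $T_{\boldsymbol{D}'}$.
   Context: Hard-core model on a finite graph at activity $\lambda>0$: distribution on independent sets $I$ with $\mu(I)\propto\lambda^{|I|}$; $p_v(\tau)$ is the probability that $v$ is unoccupied conditioned on a configuration $\tau$ on a set of vertices. For an infinite locally finite rooted tree $T$ with root $r$, $T_L$ is the subtree induced by vertices at depth $\le L$. WSM holds for $T$ at $\lambda$ if there is $\gamma\in(0,1)$ such that for all $L$ and all configurations $\tau_1,\tau_2$ on the depth-$L$ vertices of $T_L$, $|p_r(\tau_1)-p_r(\tau_2)|\le\gamma^L$ (computed in $T_L$). SSM holds for $T$ at $\lambda$ if there is $\gamma\in(0,1)$ such that for all $L$, every vertex set $S$ of $T_L$, every $S'\subseteq S$ and every $\tau_1,\tau_2$ on $S$ agreeing on $S\setminus S'$, $|p_r(\tau_1)-p_r(\tau_2)|\le\gamma^{\mathrm{dist}(r,S')}$ (computed in $T_L$). $T_{\boldsymbol{D}'}$ is the rooted tree of walks in $\mathbb{Z}^2$ from the origin (steps $N=(0,1),S=(0,-1),E=(1,0),W=(-1,0)$) generated as follows: the root has state $O$; a vertex in a state has one child for each listed state, the child extending the walk by the step given by the last letter of the child's state name: $O\to N|E|W$; $N\to E|W|NN$; $E\to N|E$; $W\to N|W$; $NN\to NN|NNE|NNW$; $NNE\to N|NEE$; $NEE\to N|E|EES$; $EES\to ESE$; $ESE\to SEE$; $SEE\to EEN$; $EEN\to N|E$; $NNW\to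 N|NWW$; $NWW\to N|W|WWS$; $WWS\to WSW$; $WSW\to SWW$; $SWW\to WWN$; $WWN\to N|W$. -}

module Defs where

open import Data.Bool using (Bool; true; false; _∧_; _∨_; not; if_then_else_)
open import Data.Maybe using (Maybe; just; nothing)
open import Data.Nat using (ℕ; zero; suc) renaming (_⊔_ to _⊔ℕ_)
open import Data.Integer using (+_)
open import Data.List using (List; []; _∷_; map; concatMap)
open import Data.Product using (_×_; _,_; Σ-syntax)
open import Data.Rational using (ℚ; 0ℚ; 1ℚ; _+_; _-_; _*_; _/_; _÷_; ∣_∣; _≤_; _<_; ≢-nonZero)
open import Data.Rational.Properties using (_≟_)
open import Relation.Nullary using (¬_; yes; no)
open import Relation.Binary.PropositionalEquality using (_≡_)

-- The tree T_{D'} (as an unfolding of its finite state description)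

data State : Set where
  O N E W NN NNE NEE EES ESE SEE EEN NNW NWW WWS WSW SWW WWN : State

children : State → List State
children O   = N ∷ E ∷ W ∷ []
children N   = E ∷ W ∷ NN ∷ []
children E   = N ∷ E ∷ []
children W   = N ∷ W ∷ []
children NN  = NN ∷ NNE ∷ NNW ∷ []
children NNE = N ∷ NEE ∷ []
children NEE = N ∷ E ∷ EES ∷ []
children EES = ESE ∷ []
children ESE = SEE ∷ []
children SEE = EEN ∷ []
children EEN = N ∷ E ∷ []
children NNW = N ∷ NWW ∷ []
children NWW = N ∷ W ∷ WWS ∷ []
children WWS = WSW ∷ []
children WSW = SWW ∷ []
children SWW = WWN ∷ []
children WWN = N ∷ W ∷ []

data Tree : Set where
  node : List Tree → Tree

unfold : ℕ → State → Tree
unfold zero    s = node []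
unfold (suc L) s = node (map (unfold L) (children s))

TD' : ℕ → Tree
TD' L = unfold L O

mutual
  data Lab (A : Set) : Tree → Set where
    lnode : ∀ {ts} → A → Labs A ts → Lab A (node ts)

  data Labs (A : Set) : List Tree → Set where
    []  : Labs A []
    _∷_ : ∀ {t ts} → Lab A t → Labs A ts → Labs A (t ∷ ts)

rootLabel : ∀ {A t} → Lab A t → A
rootLabel (lnode a _) = a

mutual
  allLab : (t : Tree) → List (Lab Bool t)
  allLab (node ts) = concatMap (λ b → map (lnode b) (allLabs ts)) (true ∷ false ∷ [])

  allLabs : (ts : List Tree) → List (Labs Bool ts)
  allLabs []       = [] ∷ []
  allLabs (t ∷ ts) = concatMap (λ x → map (x ∷_) (allLabs ts)) (allLab t)

-- σ (true = occupied) is an independent set: no parent/child both occupied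
mutual
  indep : ∀ {t} → Lab Bool t → Bool
  indep (lnode b cs) = (not b ∨ noneOcc cs) ∧ indeps cs

  indeps : ∀ {ts} → Labs Bool ts → Bool
  indeps []       = true
  indeps (c ∷ cs) = indep c ∧ indeps cs

  noneOcc : ∀ {ts} → Labs Bool ts → Bool
  noneOcc []       = true
  noneOcc (c ∷ cs) = not (rootLabel c) ∧ noneOcc cs

mutual
  weight : ℚ → ∀ {t} → Lab Bool t → ℚ
  weight λ' (lnode b cs) = (if b then λ' else 1ℚ) * weights λ' cs

  weights : ℚ → ∀ {ts} → Labs Bool ts → ℚ
  weights λ' []       = 1ℚ
  weights λ' (c ∷ cs) = weight λ' c * weights λ' cs

-- partial configurations: nothing = vertex not in the conditioned set S,
-- just b = vertex in S with occupation b
PConf : Tree → Set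
PConf = Lab (Maybe Bool)

agreeB : Bool → Maybe Bool → Bool
agreeB b nothing        = true
agreeB true (just true)   = true
agreeB false (just false) = true
agreeB _ _                = false

mutual
  compat : ∀ {t} → Lab Bool t → PConf t → Bool
  compat (lnode b cs) (lnode m ds) = agreeB b m ∧ compats cs ds

  compats : ∀ {ts} → Labs Bool ts → Labs (Maybe Bool) ts → Bool
  compats []       []       = true
  compats (c ∷ cs) (d ∷ ds) = compat c d ∧ compats cs ds

sumℚ : List ℚ → ℚ
sumℚ []       = 0ℚ
sumℚ (x ∷ xs) = x + sumℚ xs

Zc : ℚ → (t : Tree) → PConf t → ℚ
Zc λ' t τ = sumℚ (map (λ σ → if indep σ ∧ compat σ τ then weight λ' σ else 0ℚ) (allLab t))

Zc0 : ℚ → (t : Tree) → PConf t → ℚ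
Zc0 λ' t τ = sumℚ (map (λ σ → if indep σ ∧ compat σ τ ∧ not (rootLabel σ)
                                then weight λ' σ else 0ℚ) (allLab t))

-- p_r(τ) = Pr(root unoccupied | τ); value 0 (junk) if τ has probability 0
pRoot : ℚ → (t : Tree) → PConf t → ℚ
pRoot λ' t τ with Zc λ' t τ ≟ 0ℚ
... | yes _  = 0ℚ
... | no z≢0 = _÷_ (Zc0 λ' t τ) (Zc λ' t τ) {{≢-nonZero z≢0}}

isJust : Maybe Bool → Bool
isJust nothing  = false
isJust (just _) = true

mutual
  supp : ∀ {t} → PConf t → Lab Bool t
  supp (lnode m ds) = lnode (isJust m) (supps ds)

  supps : ∀ {ts} → Labs (Maybe Bool) ts → Labs Bool ts
  supps []       = []
  supps (d ∷ ds) = supp d ∷ supps ds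

mutual
  depthSet : ℕ → (t : Tree) → Lab Bool t
  depthSet zero    (node ts) = lnode true  (noneSet ts)
  depthSet (suc L) (node ts) = lnode false (depthSets L ts)

  depthSets : ℕ → (ts : List Tree) → Labs Bool ts
  depthSets L []       = []
  depthSets L (t ∷ ts) = depthSet L t ∷ depthSets L ts

  noneSet : (ts : List Tree) → Labs Bool ts
  noneSet []              = []
  noneSet (node us ∷ ts)  = lnode false (noneSet us) ∷ noneSet ts

mutual
  subsetB : ∀ {t} → Lab Bool t → Lab Bool t → Bool
  subsetB (lnode a as) (lnode b bs) = (not a ∨ b) ∧ subsetsB as bs

  subsetsB : ∀ {ts} → Labs Bool ts → Labs Bool ts → Bool
  subsetsB []       []       = true
  subsetsB (a ∷ as) (b ∷ bs) = subsetB a b ∧ subsetsB as bs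

eqMB : Maybe Bool → Maybe Bool → Bool
eqMB nothing nothing           = true
eqMB (just true) (just true)   = true
eqMB (just false) (just false) = true
eqMB _ _                       = false

mutual
  agreeOff : ∀ {t} → Lab Bool t → PConf t → PConf t → Bool
  agreeOff (lnode s ss) (lnode x xs) (lnode y ys) = (s ∨ eqMB x y) ∧ agreeOffs ss xs ys

  agreeOffs : ∀ {ts} → Labs Bool ts → Labs (Maybe Bool) ts → Labs (Maybe Bool) ts → Bool
  agreeOffs []       []       []       = true
  agreeOffs (s ∷ ss) (x ∷ xs) (y ∷ ys) = agreeOff s x y ∧ agreeOffs ss xs ys

minM : Maybe ℕ → Maybe ℕ → Maybe ℕ
minM nothing  m        = m
minM (just a) nothing  = just a
minM (just a) (just b) = just (Data.Nat._⊓_ a b)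

mutual
  distRoot : ∀ {t} → Lab Bool t → Maybe ℕ
  distRoot (lnode true  cs) = just 0
  distRoot (lnode false cs) = Data.Maybe.map suc (distRoots cs)

  distRoots : ∀ {ts} → Labs Bool ts → Maybe ℕ
  distRoots []       = nothing
  distRoots (c ∷ cs) = minM (distRoot c) (distRoots cs)

_^ℚ_ : ℚ → ℕ → ℚ
x ^ℚ zero  = 1ℚ
x ^ℚ suc n = x * (x ^ℚ n)

-- γ^{dist(r,S')}, with the convention γ^∞ = 0 when S' = ∅
powDist : ℚ → Maybe ℕ → ℚ
powDist γ nothing  = 0ℚ
powDist γ (just d) = γ ^ℚ d

-- WSM and SSM for a rooted infinite tree, given by its truncations T_L

WSM : ℚ → (ℕ → Tree) → Set
WSM λ' T = Σ[ γ ∈ ℚ ] (0ℚ < γ × γ < 1ℚ ×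
  (∀ (L : ℕ) (τ₁ τ₂ : PConf (T L)) →
     supp τ₁ ≡ depthSet L (T L) → supp τ₂ ≡ depthSet L (T L) →
     ∣ pRoot λ' (T L) τ₁ - pRoot λ' (T L) τ₂ ∣ ≤ γ ^ℚ L))

SSM : ℚ → (ℕ → Tree) → Set
SSM λ' T = Σ[ γ ∈ ℚ ] (0ℚ < γ × γ < 1ℚ ×
  (∀ (L : ℕ) (S S' : Lab Bool (T L)) (τ₁ τ₂ : PConf (T L)) →
     subsetB S' S ≡ true →
     supp τ₁ ≡ S → supp τ₂ ≡ S →
     agreeOff S' τ₁ τ₂ ≡ true →
     0ℚ < Zc λ' (T L) τ₁ → 0ℚ < Zc λ' (T L) τ₂ →
     ∣ pRoot λ' (T L) τ₁ - pRoot λ' (T L) τ₂ ∣ ≤ powDist γ (distRoot S')))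

λ₀ : ℚ
λ₀ = + 31 / 10

module Submission where

-- For a vertex v whose subtree is free except at the leaves, the probability p_v that v is unoccupied
-- satisfies p_v = 1 / (1 + λ ∏_c p_c) over its children c, and the subtree of v in T_{D'} depends only
-- on the state of v, so bounds on p_v can be propagated state by state.
--
-- WSM: an interval iteration, computed in fixed point and checked exactly, confines p_r to an interval
-- of width at most γ^L (γ = 499/500) whenever the boundary is at depth L ≤ 1000. From depth 1000 on the
-- intervals are stable, and inside them a weighted contraction shows that the difference of p_v under
-- two boundary conditions shrinks by γ per level.
--
-- ¬SSM: pinning the EES and WWS vertices unoccupied (identically in both boundary conditions) leaves a
-- tree on which the recursion swaps two certified families of intervals, a high and a low phase, from
-- one level to the next. With all other leaves unoccupied, resp. occupied, p_r is in opposite phases,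
-- at least 0.11 apart, although the two conditions differ only at distance L; this contradicts any
-- bound γ'^L with γ' < 1.

open import Defs
open import Algebra.Bundles using (Ring)
open import Level using (0ℓ)
open import Data.Bool using (Bool; true; false; T; not; _∧_; _∨_; if_then_else_)
open import Data.Bool.ListAction using (all)
open import Data.Bool.Properties as Bool using (∧-zeroʳ; ∧-identityʳ; ∨-zeroʳ; T-∧; ∨-∧-commutativeSemiring)
open import Data.Empty using (⊥; ⊥-elim)
open import Data.Fin using (Fin; #_)
open import Data.Integer using (+_; +[1+_]; -[1+_])
import Data.Integer as ℤ
import Data.Integer.Properties as ℤ
open import Data.Integer.Tactic.RingSolver using () renaming (solve-∀ to ℤ-solve-∀)
open import Data.List using (List; []; _∷_; _++_; map; concatMap; allFin; length; null)
open import Data.List.Membership.Propositional.Properties using (∈-allFin)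
open import Data.List.Properties using (map-++; map-cong; map-∘)
open import Data.List.Relation.Unary.All using () renaming (lookup to All-lookup)
open import Data.List.Relation.Unary.All.Properties using (all⁺)
open import Data.Maybe using (Maybe; just; nothing)
import Data.Maybe as Maybe
open import Data.Nat using (ℕ; zero; suc; z≤n; s≤s)
import Data.Nat as ℕ
import Data.Nat.Properties as ℕ
open import Data.Product using (_×_; _,_; proj₁; proj₂; ∃-syntax; uncurry)
open import Data.Rational
  using (ℚ; mkℚ; 0ℚ; 1ℚ; _+_; _*_; _-_; -_; _÷_; 1/_; _/_; ∣_∣; _≤_; _<_; *<*
        ; NonZero; ≢-nonZero; nonNegative; positive; toℚᵘ; fromℚᵘ)
open import Data.Rational.Properties
  using (≤-refl; ≤-trans; ≤-reflexive; <⇒≤; <-irrefl; <-≤-trans; _≟_; _<?_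
        ; +-assoc; +-identityˡ; +-identityʳ; +-inverseʳ; +-mono-≤; +-monoˡ-≤; +-monoʳ-≤; +-monoˡ-<; neg-antimono-≤
        ; *-assoc; *-identityˡ; *-identityʳ; *-zeroˡ; *-zeroʳ; *-inverseˡ; *-distribˡ-+; *-distribʳ-+
        ; *-monoˡ-≤-nonNeg; *-monoʳ-≤-nonNeg; *-cancelʳ-≤-pos; *-cancelʳ-<-nonNeg
        ; nonNegative⁻¹; positive⁻¹; nonNeg*nonNeg⇒nonNeg; pos*pos⇒pos; nonNeg+nonNeg⇒nonNeg; nonNeg+pos⇒pos
        ; 0≤∣p∣; ∣-p∣≡∣p∣; ∣p∣≡p∨∣p∣≡-p
        ; toℚᵘ-fromℚᵘ; toℚᵘ-homo-+; toℚᵘ-homo-*; toℚᵘ-cancel-≤; +-*-ring; +-*-commutativeRing; module ≤-Reasoning)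
open import Data.Rational.Unnormalised as ℚᵘ using (ℚᵘ; mkℚᵘ; _≃_; *≡*; *≤*)
import Data.Rational.Unnormalised.Properties as ℚᵘ
open import Algebra.Properties.Semiring.Mult (Ring.semiring +-*-ring) using (×-assocˡ; ×-comm-*) renaming (_×_ to _·_)
open import Data.Sum using (_⊎_; inj₁; inj₂)
open import Data.Unit using (⊤; tt)
open import Data.Vec using (Vec; lookup; tabulate; []; _∷_)
open import Data.Vec.Properties using (lookup∘tabulate)
open import Function using (_∘_)
open import Function.Bundles using (Equivalence)
open import Relation.Binary.PropositionalEquality using (_≡_; refl; sym; trans; cong; cong₂; subst; subst₂; module ≡-Reasoning)
open import Relation.Nullary using (¬_; yes; no)
open import Relation.Nullary.Decidable using (toWitness; dec⇒maybe)
open import Tactic.RingSolver.Core.AlmostCommutativeRing using (AlmostCommutativeRing; fromCommutativeRing; fromCommutativeSemiring)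
open import Tactic.RingSolver using (solve-∀)

ℚ-ring : AlmostCommutativeRing 0ℓ 0ℓ
ℚ-ring = fromCommutativeRing +-*-commutativeRing (λ x → dec⇒maybe (0ℚ ≟ x))

Bool-ring : AlmostCommutativeRing 0ℓ 0ℓ
Bool-ring = fromCommutativeSemiring ∨-∧-commutativeSemiring (λ b → dec⇒maybe (false Bool.≟ b))

when : Bool → ℚ → ℚ
when a x = if a then x else 0ℚ

when-*ˡ : ∀ a c x → when a (c * x) ≡ c * when a x
when-*ˡ true  c x = refl
when-*ˡ false c x = sym (*-zeroʳ c)

when-∧-* : ∀ a b x y → when (a ∧ b) (x * y) ≡ when a x * when b y
when-∧-* true  true  x y = refl
when-∧-* true  false x y = sym (*-zeroʳ x)
when-∧-* false b     x y = sym (*-zeroˡ (when b y))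

when-∧-pull : ∀ a x y c w → when (x ∧ (a ∧ y)) (c * w) ≡ when a (c * when (x ∧ y) w)
when-∧-pull true  x y c w = when-*ˡ (x ∧ y) c w
when-∧-pull false x y c w = cong (λ b → when b (c * w)) (∧-zeroʳ x)

module _ {A : Set} where

  sumℚ-cong : ∀ {f g : A → ℚ} → (∀ x → f x ≡ g x) → ∀ xs → sumℚ (map f xs) ≡ sumℚ (map g xs)
  sumℚ-cong f≗g xs = cong sumℚ (map-cong f≗g xs)

  sumℚ-*ˡ : ∀ c (f : A → ℚ) xs → sumℚ (map (λ x → c * f x) xs) ≡ c * sumℚ (map f xs)
  sumℚ-*ˡ c f []       = sym (*-zeroʳ c)
  sumℚ-*ˡ c f (x ∷ xs) = trans (cong (λ y → c * f x + y) (sumℚ-*ˡ c f xs)) (sym (*-distribˡ-+ c (f x) _))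

  sumℚ-*ʳ : ∀ c (f : A → ℚ) xs → sumℚ (map (λ x → f x * c) xs) ≡ sumℚ (map f xs) * c
  sumℚ-*ʳ c f []       = sym (*-zeroˡ c)
  sumℚ-*ʳ c f (x ∷ xs) = trans (cong (λ y → f x * c + y) (sumℚ-*ʳ c f xs)) (sym (*-distribʳ-+ c (f x) _))

  sumℚ-when : ∀ a (f : A → ℚ) xs → sumℚ (map (λ x → when a (f x)) xs) ≡ when a (sumℚ (map f xs))
  sumℚ-when true  f xs       = refl
  sumℚ-when false f []       = refl
  sumℚ-when false f (x ∷ xs) = trans (+-identityˡ _) (sumℚ-when false f xs)

sumℚ-++ : ∀ xs ys → sumℚ (xs ++ ys) ≡ sumℚ xs + sumℚ ys
sumℚ-++ []       ys = sym (+-identityˡ _)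
sumℚ-++ (x ∷ xs) ys = trans (cong (λ y → x + y) (sumℚ-++ xs ys)) (sym (+-assoc x _ _))

sumℚ-concatMap : ∀ {A B : Set} (g : B → ℚ) (f : A → List B) xs →
  sumℚ (map g (concatMap f xs)) ≡ sumℚ (map (λ x → sumℚ (map g (f x))) xs)
sumℚ-concatMap g f []       = refl
sumℚ-concatMap g f (x ∷ xs) = begin
  sumℚ (map g (f x ++ concatMap f xs))                ≡⟨ cong sumℚ (map-++ g (f x) _) ⟩
  sumℚ (map g (f x) ++ map g (concatMap f xs))        ≡⟨ sumℚ-++ (map g (f x)) _ ⟩
  sumℚ (map g (f x)) + sumℚ (map g (concatMap f xs))  ≡⟨ cong (λ y → sumℚ (map g (f x)) + y) (sumℚ-concatMap g f xs) ⟩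
  sumℚ (map g (f x)) + sumℚ (map (λ x → sumℚ (map g (f x))) xs) ∎
  where open ≡-Reasoning

Summand : Set
Summand = ∀ {t} → PConf t → Lab Bool t → ℚ

prodSummands : Summand → ∀ {ts} → Labs (Maybe Bool) ts → Labs Bool ts → ℚ
prodSummands G []       []       = 1ℚ
prodSummands G (τ ∷ τs) (σ ∷ σs) = G τ σ * prodSummands G τs σs

prodSums : Summand → (ts : List Tree) → Labs (Maybe Bool) ts → ℚ
prodSums G []       []       = 1ℚ
prodSums G (t ∷ ts) (τ ∷ τs) = sumℚ (map (G τ) (allLab t)) * prodSums G ts τs

sum-prodSummands : ∀ (G : Summand) ts (τs : Labs (Maybe Bool) ts) →
  sumℚ (map (prodSummands G τs) (allLabs ts)) ≡ prodSums G ts τs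
sum-prodSummands G []       []       = +-identityʳ 1ℚ
sum-prodSummands G (t ∷ ts) (τ ∷ τs) = begin
  sumℚ (map (prodSummands G (τ ∷ τs)) (allLabs (t ∷ ts)))
    ≡⟨ sumℚ-concatMap (prodSummands G (τ ∷ τs)) (λ σ → map (σ ∷_) (allLabs ts)) (allLab t) ⟩
  sumℚ (map (λ σ → sumℚ (map (prodSummands G (τ ∷ τs)) (map (σ ∷_) (allLabs ts)))) (allLab t))
    ≡⟨ sumℚ-cong row (allLab t) ⟩
  sumℚ (map (λ σ → G τ σ * prodSums G ts τs) (allLab t))
    ≡⟨ sumℚ-*ʳ (prodSums G ts τs) (G τ) (allLab t) ⟩
  prodSums G (t ∷ ts) (τ ∷ τs) ∎
  where
  open ≡-Reasoning
  row : ∀ σ → sumℚ (map (prodSummands G (τ ∷ τs)) (map (σ ∷_) (allLabs ts))) ≡ G τ σ * prodSums G ts τs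
  row σ = begin
    sumℚ (map (prodSummands G (τ ∷ τs)) (map (σ ∷_) (allLabs ts))) ≡⟨ cong sumℚ (sym (map-∘ (allLabs ts))) ⟩
    sumℚ (map (λ σs → G τ σ * prodSummands G τs σs) (allLabs ts))   ≡⟨ sumℚ-*ˡ (G τ σ) _ (allLabs ts) ⟩
    G τ σ * sumℚ (map (prodSummands G τs) (allLabs ts))             ≡⟨ cong (G τ σ *_) (sum-prodSummands G ts τs) ⟩
    G τ σ * prodSums G ts τs ∎

Z-summand : ℚ → Summand
Z-summand λ' τ σ = when (indep σ ∧ compat σ τ) (weight λ' σ)

Z0-summand : ℚ → Summand
Z0-summand λ' τ σ = when (indep σ ∧ compat σ τ ∧ not (rootLabel σ)) (weight λ' σ)

ΠZ : ℚ → (ts : List Tree) → Labs (Maybe Bool) ts → ℚ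
ΠZ λ' = prodSums (Z-summand λ')

ΠZ0 : ℚ → (ts : List Tree) → Labs (Maybe Bool) ts → ℚ
ΠZ0 λ' = prodSums (Z0-summand λ')

Z-summand-children : ∀ λ' {ts} (σs : Labs Bool ts) τs →
  when (indeps σs ∧ compats σs τs) (weights λ' σs) ≡ prodSummands (Z-summand λ') τs σs
Z-summand-children λ' []       []       = refl
Z-summand-children λ' (σ ∷ σs) (τ ∷ τs) = begin
  when ((indep σ ∧ indeps σs) ∧ (compat σ τ ∧ compats σs τs)) (weight λ' σ * weights λ' σs)
    ≡⟨ cong (λ b → when b _) (interchange (indep σ) (indeps σs) (compat σ τ) (compats σs τs)) ⟩
  when ((indep σ ∧ compat σ τ) ∧ (indeps σs ∧ compats σs τs)) (weight λ' σ * weights λ' σs)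
    ≡⟨ when-∧-* (indep σ ∧ compat σ τ) _ (weight λ' σ) (weights λ' σs) ⟩
  Z-summand λ' τ σ * when (indeps σs ∧ compats σs τs) (weights λ' σs)
    ≡⟨ cong (Z-summand λ' τ σ *_) (Z-summand-children λ' σs τs) ⟩
  Z-summand λ' τ σ * prodSummands (Z-summand λ') τs σs ∎
  where
  open ≡-Reasoning
  interchange : ∀ a b c d → (a ∧ b) ∧ (c ∧ d) ≡ (a ∧ c) ∧ (b ∧ d)
  interchange = solve-∀ Bool-ring

Z0-summand-children : ∀ λ' {ts} (σs : Labs Bool ts) τs →
  when ((noneOcc σs ∧ indeps σs) ∧ compats σs τs) (weights λ' σs) ≡ prodSummands (Z0-summand λ') τs σs
Z0-summand-children λ' []       []       = refl
Z0-summand-children λ' (σ ∷ σs) (τ ∷ τs) = begin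
  when (((not (rootLabel σ) ∧ noneOcc σs) ∧ (indep σ ∧ indeps σs)) ∧ (compat σ τ ∧ compats σs τs))
       (weight λ' σ * weights λ' σs)
    ≡⟨ cong (λ b → when b _) (regroup (not (rootLabel σ)) (noneOcc σs) (indep σ) (indeps σs) (compat σ τ) (compats σs τs)) ⟩
  when ((indep σ ∧ compat σ τ ∧ not (rootLabel σ)) ∧ ((noneOcc σs ∧ indeps σs) ∧ compats σs τs))
       (weight λ' σ * weights λ' σs)
    ≡⟨ when-∧-* (indep σ ∧ compat σ τ ∧ not (rootLabel σ)) _ (weight λ' σ) (weights λ' σs) ⟩
  Z0-summand λ' τ σ * when ((noneOcc σs ∧ indeps σs) ∧ compats σs τs) (weights λ' σs)
    ≡⟨ cong (Z0-summand λ' τ σ *_) (Z0-summand-children λ' σs τs) ⟩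
  Z0-summand λ' τ σ * prodSummands (Z0-summand λ') τs σs ∎
  where
  open ≡-Reasoning
  regroup : ∀ r n i I k K → ((r ∧ n) ∧ (i ∧ I)) ∧ (k ∧ K) ≡ (i ∧ k ∧ r) ∧ ((n ∧ I) ∧ K)
  regroup = solve-∀ Bool-ring

sum-allLab-node : ∀ ts (f : Lab Bool (node ts) → ℚ) →
  sumℚ (map f (allLab (node ts))) ≡ sumℚ (map (f ∘ lnode true) (allLabs ts)) + sumℚ (map (f ∘ lnode false) (allLabs ts))
sum-allLab-node ts f = begin
  sumℚ (map f (allLab (node ts)))
    ≡⟨ sumℚ-concatMap f (λ b → map (lnode b) (allLabs ts)) (true ∷ false ∷ []) ⟩
  sumℚ (map f (map (lnode true) (allLabs ts))) + (sumℚ (map f (map (lnode false) (allLabs ts))) + 0ℚ)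
    ≡⟨ cong₂ _+_ (cong sumℚ (sym (map-∘ (allLabs ts)))) (trans (+-identityʳ _) (cong sumℚ (sym (map-∘ (allLabs ts))))) ⟩
  sumℚ (map (f ∘ lnode true) (allLabs ts)) + sumℚ (map (f ∘ lnode false) (allLabs ts)) ∎
  where open ≡-Reasoning

-- the shape in which Zc presents the sum over the labellings with a fixed root label
sum-guarded : ∀ {A : Set} a c (X Y : A → Bool) (w : A → ℚ) xs →
  sumℚ (map (λ x → when (X x ∧ (a ∧ Y x)) (c * w x)) xs) ≡ when a (c * sumℚ (map (λ x → when (X x ∧ Y x) (w x)) xs))
sum-guarded a c X Y w xs = begin
  sumℚ (map (λ x → when (X x ∧ (a ∧ Y x)) (c * w x)) xs)    ≡⟨ sumℚ-cong pull xs ⟩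
  sumℚ (map (λ x → when a (c * when (X x ∧ Y x) (w x))) xs) ≡⟨ sumℚ-when a _ xs ⟩
  when a (sumℚ (map (λ x → c * when (X x ∧ Y x) (w x)) xs)) ≡⟨ cong (when a) (sumℚ-*ˡ c _ xs) ⟩
  when a (c * sumℚ (map (λ x → when (X x ∧ Y x) (w x)) xs)) ∎
  where
  open ≡-Reasoning
  pull : ∀ x → when (X x ∧ (a ∧ Y x)) (c * w x) ≡ when a (c * when (X x ∧ Y x) (w x))
  pull x = when-∧-pull a (X x) (Y x) c (w x)

root-unoccupied-sum : ∀ λ' ts m (τs : Labs (Maybe Bool) ts) →
  sumℚ (map (λ σs → when (indeps σs ∧ (agreeB false m ∧ compats σs τs)) (1ℚ * weights λ' σs)) (allLabs ts))
  ≡ when (agreeB false m) (ΠZ λ' ts τs)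
root-unoccupied-sum λ' ts m τs = begin
  _ ≡⟨ sum-guarded (agreeB false m) 1ℚ indeps (λ σs → compats σs τs) (weights λ') (allLabs ts) ⟩
  when (agreeB false m) (1ℚ * sumℚ (map (λ σs → when (indeps σs ∧ compats σs τs) (weights λ' σs)) (allLabs ts)))
    ≡⟨ cong (when (agreeB false m)) (trans (*-identityˡ _)
         (trans (sumℚ-cong (λ σs → Z-summand-children λ' σs τs) (allLabs ts)) (sum-prodSummands (Z-summand λ') ts τs))) ⟩
  when (agreeB false m) (ΠZ λ' ts τs) ∎
  where open ≡-Reasoning

Zc-node : ∀ λ' ts m (τs : Labs (Maybe Bool) ts) →
  Zc λ' (node ts) (lnode m τs) ≡ when (agreeB true m) (λ' * ΠZ0 λ' ts τs) + when (agreeB false m) (ΠZ λ' ts τs)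
Zc-node λ' ts m τs = trans (sum-allLab-node ts _) (cong₂ _+_ occupied (root-unoccupied-sum λ' ts m τs))
  where
  occupied : sumℚ (map (λ σs → when ((noneOcc σs ∧ indeps σs) ∧ (agreeB true m ∧ compats σs τs)) (λ' * weights λ' σs)) (allLabs ts))
             ≡ when (agreeB true m) (λ' * ΠZ0 λ' ts τs)
  occupied = trans (sum-guarded (agreeB true m) λ' (λ σs → noneOcc σs ∧ indeps σs) (λ σs → compats σs τs) (weights λ') (allLabs ts))
                   (cong (λ x → when (agreeB true m) (λ' * x))
                     (trans (sumℚ-cong (λ σs → Z0-summand-children λ' σs τs) (allLabs ts)) (sum-prodSummands (Z0-summand λ') ts τs)))

Zc0-node : ∀ λ' ts m (τs : Labs (Maybe Bool) ts) →
  Zc0 λ' (node ts) (lnode m τs) ≡ when (agreeB false m) (ΠZ λ' ts τs)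
Zc0-node λ' ts m τs = begin
  Zc0 λ' (node ts) (lnode m τs)
    ≡⟨ sum-allLab-node ts (Z0-summand λ' (lnode m τs)) ⟩
  sumℚ (map (Z0-summand λ' (lnode m τs) ∘ lnode true) (allLabs ts))
    + sumℚ (map (Z0-summand λ' (lnode m τs) ∘ lnode false) (allLabs ts))
    ≡⟨ cong₂ _+_ (trans (sumℚ-cong occupied-excluded (allLabs ts)) (sumℚ-when false (λ _ → 0ℚ) (allLabs ts)))
                 (trans (sumℚ-cong unoccupied (allLabs ts)) (root-unoccupied-sum λ' ts m τs)) ⟩
  0ℚ + when (agreeB false m) (ΠZ λ' ts τs)
    ≡⟨ +-identityˡ _ ⟩
  when (agreeB false m) (ΠZ λ' ts τs) ∎
  where
  open ≡-Reasoning
  occupied-excluded : ∀ σs → Z0-summand λ' (lnode m τs) (lnode true σs) ≡ when false 0ℚ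
  occupied-excluded σs = cong (λ b → when b (λ' * weights λ' σs))
    (trans (cong ((noneOcc σs ∧ indeps σs) ∧_) (∧-zeroʳ (agreeB true m ∧ compats σs τs))) (∧-zeroʳ _))
  unoccupied : ∀ σs → Z0-summand λ' (lnode m τs) (lnode false σs)
                      ≡ when (indeps σs ∧ (agreeB false m ∧ compats σs τs)) (1ℚ * weights λ' σs)
  unoccupied σs = cong (λ b → when (indeps σs ∧ b) (1ℚ * weights λ' σs)) (∧-identityʳ _)

nonNeg*nonNeg′ : ∀ {p q} → 0ℚ ≤ p → 0ℚ ≤ q → 0ℚ ≤ p * q
nonNeg*nonNeg′ {p} {q} 0≤p 0≤q = nonNegative⁻¹ (p * q) {{nonNeg*nonNeg⇒nonNeg p {{nonNegative 0≤p}} q {{nonNegative 0≤q}}}}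

pos*pos′ : ∀ {p q} → 0ℚ < p → 0ℚ < q → 0ℚ < p * q
pos*pos′ {p} {q} 0<p 0<q = positive⁻¹ (p * q) {{pos*pos⇒pos p {{positive 0<p}} q {{positive 0<q}}}}

nonNeg+nonNeg′ : ∀ {p q} → 0ℚ ≤ p → 0ℚ ≤ q → 0ℚ ≤ p + q
nonNeg+nonNeg′ {p} {q} 0≤p 0≤q = nonNegative⁻¹ (p + q) {{nonNeg+nonNeg⇒nonNeg p {{nonNegative 0≤p}} q {{nonNegative 0≤q}}}}

nonNeg+pos′ : ∀ {p q} → 0ℚ ≤ p → 0ℚ < q → 0ℚ < p + q
nonNeg+pos′ {p} {q} 0≤p 0<q = positive⁻¹ (p + q) {{nonNeg+pos⇒pos p {{nonNegative 0≤p}} q {{positive 0<q}}}}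

*-monoˡ-≤-nonNeg′ : ∀ {p q r} → 0ℚ ≤ r → p ≤ q → r * p ≤ r * q
*-monoˡ-≤-nonNeg′ {r = r} 0≤r = *-monoˡ-≤-nonNeg r {{nonNegative 0≤r}}

*-monoʳ-≤-nonNeg′ : ∀ {p q r} → 0ℚ ≤ r → p ≤ q → p * r ≤ q * r
*-monoʳ-≤-nonNeg′ {r = r} 0≤r = *-monoʳ-≤-nonNeg r {{nonNegative 0≤r}}

*-mono-≤-nonNeg′ : ∀ {p q r s} → 0ℚ ≤ p → 0ℚ ≤ r → p ≤ q → r ≤ s → p * r ≤ q * s
*-mono-≤-nonNeg′ 0≤p 0≤r p≤q r≤s = ≤-trans (*-monoʳ-≤-nonNeg′ 0≤r p≤q) (*-monoˡ-≤-nonNeg′ (≤-trans 0≤p p≤q) r≤s)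

*-cancelʳ-≤-pos′ : ∀ {p q r} → 0ℚ < r → p * r ≤ q * r → p ≤ q
*-cancelʳ-≤-pos′ {r = r} 0<r = *-cancelʳ-≤-pos r {{positive 0<r}}

^ℚ-nonNeg : ∀ {x} → 0ℚ ≤ x → ∀ n → 0ℚ ≤ x ^ℚ n
^ℚ-nonNeg 0≤x zero    = <⇒≤ (positive⁻¹ 1ℚ)
^ℚ-nonNeg 0≤x (suc n) = nonNeg*nonNeg′ 0≤x (^ℚ-nonNeg 0≤x n)

p-q≤p : ∀ {p q} → 0ℚ ≤ q → p - q ≤ p
p-q≤p {p} 0≤q = ≤-trans (+-monoʳ-≤ p (neg-antimono-≤ 0≤q)) (≤-reflexive (+-identityʳ p))

x-y≤width : ∀ {x y l u w} → x ≤ u → l ≤ y → u ≤ l + w → x - y ≤ w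
x-y≤width {x} {y} {l} {u} {w} x≤u l≤y u≤l+w = begin
  x - y       ≤⟨ +-mono-≤ (≤-trans x≤u u≤l+w) (neg-antimono-≤ l≤y) ⟩
  l + w - l   ≡⟨ cancel l w ⟩
  w           ∎
  where
  open ≤-Reasoning
  cancel : ∀ l w → l + w - l ≡ w
  cancel = solve-∀ ℚ-ring

∣x-y∣≤ : ∀ x y {d} → x - y ≤ d → y - x ≤ d → ∣ x - y ∣ ≤ d
∣x-y∣≤ x y {d} x-y≤d y-x≤d with ∣p∣≡p∨∣p∣≡-p (x - y)
... | inj₁ ∣x-y∣≡x-y  = subst (_≤ d) (sym ∣x-y∣≡x-y) x-y≤d
... | inj₂ ∣x-y∣≡y-x = subst (_≤ d) (sym (trans ∣x-y∣≡y-x (negate x y))) y-x≤d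
  where
  negate : ∀ x y → - (x - y) ≡ y - x
  negate = solve-∀ ℚ-ring

p≤∣p∣ : ∀ p → p ≤ ∣ p ∣
p≤∣p∣ p with ∣p∣≡p∨∣p∣≡-p p
... | inj₁ ∣p∣≡p  = ≤-reflexive (sym ∣p∣≡p)
... | inj₂ ∣p∣≡-p = ≤-trans p≤0 (0≤∣p∣ p)
  where
  neg-involutive : ∀ p → - (- p) ≡ p
  neg-involutive = solve-∀ ℚ-ring
  p≤0 : p ≤ 0ℚ
  p≤0 = subst₂ _≤_ (neg-involutive p) refl (neg-antimono-≤ (subst (0ℚ ≤_) ∣p∣≡-p (0≤∣p∣ p)))

∣x-y∣≡∣y-x∣ : ∀ x y → ∣ x - y ∣ ≡ ∣ y - x ∣
∣x-y∣≡∣y-x∣ x y = trans (cong ∣_∣ (negate y x)) (∣-p∣≡∣p∣ (y - x))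
  where
  negate : ∀ y x → x - y ≡ - (y - x)
  negate = solve-∀ ℚ-ring

gap≤x-y : ∀ {a b c x y} → a ≤ x → y ≤ b → b + c ≤ a → c ≤ x - y
gap≤x-y {a} {b} {c} {x} {y} a≤x y≤b b+c≤a = begin
  c           ≡⟨ cancel b c ⟨
  b + c - b   ≤⟨ +-mono-≤ (≤-trans b+c≤a a≤x) (neg-antimono-≤ y≤b) ⟩
  x - y       ∎
  where
  open ≤-Reasoning
  cancel : ∀ b c → b + c - b ≡ c
  cancel = solve-∀ ℚ-ring

c≤∣x-y∣ : ∀ x y {c} → c ≤ x - y ⊎ c ≤ y - x → c ≤ ∣ x - y ∣
c≤∣x-y∣ x y (inj₁ c≤x-y) = ≤-trans c≤x-y (p≤∣p∣ (x - y))
c≤∣x-y∣ x y (inj₂ c≤y-x) = ≤-trans c≤y-x (≤-trans (p≤∣p∣ (y - x)) (≤-reflexive (∣x-y∣≡∣y-x∣ y x)))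

-- z₀ / z ∈ [a, b], cleared of denominators
record RatioIn (a b z₀ z : ℚ) : Set where
  constructor ratioIn
  field
    denominator-pos : 0ℚ < z
    lower           : a * z ≤ z₀
    upper           : z₀ ≤ b * z
open RatioIn public

-- z₀ / z - y₀ / y ≤ δ, cleared of denominators
RatioGap : ℚ → ℚ → ℚ → ℚ → ℚ → Set
RatioGap δ z₀ z y₀ y = z₀ * y - y₀ * z ≤ δ * (z * y)

RatioIn-numerator-nonNeg : ∀ {a b z₀ z} → 0ℚ ≤ a → RatioIn a b z₀ z → 0ℚ ≤ z₀
RatioIn-numerator-nonNeg 0≤a (ratioIn 0<z a*z≤z₀ _) = ≤-trans (nonNeg*nonNeg′ 0≤a (<⇒≤ 0<z)) a*z≤z₀

RatioIn-* : ∀ {a b z₀ z a′ b′ y₀ y} → 0ℚ ≤ a → 0ℚ ≤ a′ →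
  RatioIn a b z₀ z → RatioIn a′ b′ y₀ y → RatioIn (a * a′) (b * b′) (z₀ * y₀) (z * y)
RatioIn-* {a} {b} {z₀} {z} {a′} {b′} {y₀} {y} 0≤a 0≤a′ r@(ratioIn 0<z l u) r′@(ratioIn 0<y l′ u′) =
  ratioIn (pos*pos′ 0<z 0<y)
    (subst (_≤ z₀ * y₀) (shuffle a a′ z y)
      (*-mono-≤-nonNeg′ (nonNeg*nonNeg′ 0≤a (<⇒≤ 0<z)) (nonNeg*nonNeg′ 0≤a′ (<⇒≤ 0<y)) l l′))
    (subst (z₀ * y₀ ≤_) (shuffle b b′ z y)
      (*-mono-≤-nonNeg′ (RatioIn-numerator-nonNeg 0≤a r) (RatioIn-numerator-nonNeg 0≤a′ r′) u u′))
  where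
  shuffle : ∀ a a′ z y → (a * z) * (a′ * y) ≡ (a * a′) * (z * y)
  shuffle = solve-∀ ℚ-ring

RatioIn⇒RatioGap : ∀ {a b δ z₀ z y₀ y} → b ≤ a + δ → RatioIn a b z₀ z → RatioIn a b y₀ y → RatioGap δ z₀ z y₀ y
RatioIn⇒RatioGap {a} {b} {δ} {z₀} {z} {y₀} {y} b≤a+δ (ratioIn 0<z _ z₀≤bz) (ratioIn 0<y ay≤y₀ _) = begin
  z₀ * y - y₀ * z          ≤⟨ +-mono-≤ (*-monoʳ-≤-nonNeg′ (<⇒≤ 0<y) z₀≤bz) (neg-antimono-≤ (*-monoʳ-≤-nonNeg′ (<⇒≤ 0<z) ay≤y₀)) ⟩
  b * z * y - a * y * z    ≡⟨ factor b a z y ⟩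
  (b - a) * (z * y)        ≤⟨ *-monoʳ-≤-nonNeg′ (nonNeg*nonNeg′ (<⇒≤ 0<z) (<⇒≤ 0<y)) (≤-trans (+-monoˡ-≤ (- a) b≤a+δ) (≤-reflexive (cancel a δ))) ⟩
  δ * (z * y)              ∎
  where
  open ≤-Reasoning
  factor : ∀ b a z y → b * z * y - a * y * z ≡ (b - a) * (z * y)
  factor = solve-∀ ℚ-ring
  cancel : ∀ a δ → a + δ - a ≡ δ
  cancel = solve-∀ ℚ-ring

pRoot-*-Zc : ∀ λ' t τ → 0ℚ < Zc λ' t τ → pRoot λ' t τ * Zc λ' t τ ≡ Zc0 λ' t τ
pRoot-*-Zc λ' t τ 0<Z with Zc λ' t τ ≟ 0ℚ
... | yes Z≡0 = ⊥-elim (<-irrefl (sym Z≡0) 0<Z)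
... | no  Z≢0 = ÷-* (Zc0 λ' t τ) (Zc λ' t τ) {{≢-nonZero Z≢0}}
  where
  ÷-* : ∀ p q .{{_ : NonZero q}} → (p ÷ q) * q ≡ p
  ÷-* p q = trans (*-assoc p (1/ q) q) (trans (cong (p *_) (*-inverseˡ q)) (*-identityʳ p))

RatioIn⇒pRoot-bounds : ∀ {λ' a b} t τ → RatioIn a b (Zc0 λ' t τ) (Zc λ' t τ) → a ≤ pRoot λ' t τ × pRoot λ' t τ ≤ b
RatioIn⇒pRoot-bounds {λ'} t τ (ratioIn 0<Z l u) =
  *-cancelʳ-≤-pos′ 0<Z (≤-trans l (≤-reflexive (sym (pRoot-*-Zc λ' t τ 0<Z)))) ,
  *-cancelʳ-≤-pos′ 0<Z (≤-trans (≤-reflexive (pRoot-*-Zc λ' t τ 0<Z)) u)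

RatioGap⇒pRoot-≤ : ∀ {λ' δ} t τ τ′ → 0ℚ < Zc λ' t τ → 0ℚ < Zc λ' t τ′ →
  RatioGap δ (Zc0 λ' t τ) (Zc λ' t τ) (Zc0 λ' t τ′) (Zc λ' t τ′) → pRoot λ' t τ - pRoot λ' t τ′ ≤ δ
RatioGap⇒pRoot-≤ {λ'} t τ τ′ 0<Z 0<Z′ gap = *-cancelʳ-≤-pos′ (pos*pos′ 0<Z 0<Z′) (≤-trans (≤-reflexive cleared) gap)
  where
  p = pRoot λ' t τ
  p′ = pRoot λ' t τ′
  expand : ∀ p q z y → (p - q) * (z * y) ≡ (p * z) * y - (q * y) * z
  expand = solve-∀ ℚ-ring
  cleared : (p - p′) * (Zc λ' t τ * Zc λ' t τ′) ≡ Zc0 λ' t τ * Zc λ' t τ′ - Zc0 λ' t τ′ * Zc λ' t τ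
  cleared = trans (expand p p′ (Zc λ' t τ) (Zc λ' t τ′))
                  (cong₂ (λ u v → u * Zc λ' t τ′ - v * Zc λ' t τ) (pRoot-*-Zc λ' t τ 0<Z) (pRoot-*-Zc λ' t τ′ 0<Z′))

prodℚ : {S : Set} → (S → ℚ) → List S → ℚ
prodℚ f []       = 1ℚ
prodℚ f (c ∷ cs) = f c * prodℚ f cs

prodℚ-nonNeg : ∀ {S : Set} {f : S → ℚ} → (∀ c → 0ℚ ≤ f c) → ∀ cs → 0ℚ ≤ prodℚ f cs
prodℚ-nonNeg 0≤f []       = <⇒≤ (positive⁻¹ 1ℚ)
prodℚ-nonNeg 0≤f (c ∷ cs) = nonNeg*nonNeg′ (0≤f c) (prodℚ-nonNeg 0≤f cs)

-- the bound Σᵢ δᵢ Πⱼ≠ᵢ Bⱼ on the change of a product Πᵢ rᵢ when each factor moves by δᵢ and stays below Bᵢ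
productGap : {S : Set} → (S → ℚ) → (S → ℚ) → List S → ℚ
productGap δ B []       = 0ℚ
productGap δ B (c ∷ cs) = δ c * prodℚ B cs + B c * productGap δ B cs

productGap-nonNeg : ∀ {S : Set} {δ B : S → ℚ} → (∀ c → 0ℚ ≤ δ c) → (∀ c → 0ℚ ≤ B c) → ∀ cs → 0ℚ ≤ productGap δ B cs
productGap-nonNeg 0≤δ 0≤B []       = ≤-refl
productGap-nonNeg 0≤δ 0≤B (c ∷ cs) =
  nonNeg+nonNeg′ (nonNeg*nonNeg′ (0≤δ c) (prodℚ-nonNeg 0≤B cs)) (nonNeg*nonNeg′ (0≤B c) (productGap-nonNeg 0≤δ 0≤B cs))

productGap-*ˡ : ∀ {S : Set} k (δ B : S → ℚ) cs → productGap (λ c → k * δ c) B cs ≡ k * productGap δ B cs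
productGap-*ˡ k δ B []       = sym (*-zeroʳ k)
productGap-*ˡ k δ B (c ∷ cs) = trans (cong (λ g → k * δ c * prodℚ B cs + B c * g) (productGap-*ˡ k δ B cs))
                                     (distribute k (δ c) (prodℚ B cs) (B c) (productGap δ B cs))
  where
  distribute : ∀ k d p b g → k * d * p + b * (k * g) ≡ k * (d * p + b * g)
  distribute = solve-∀ ℚ-ring

lab-children : ∀ {A ts} → Lab A (node ts) → Labs A ts
lab-children (lnode _ σs) = σs

labs-head : ∀ {A t ts} → Labs A (t ∷ ts) → Lab A t
labs-head (σ ∷ _) = σ

labs-tail : ∀ {A t ts} → Labs A (t ∷ ts) → Labs A ts
labs-tail (_ ∷ σs) = σs

LeafBoundary : (L : ℕ) (s : State) → PConf (unfold L s) → Set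
LeafBoundary L s τ = supp τ ≡ depthSet L (unfold L s)

LeafBoundaries : (L : ℕ) (cs : List State) → Labs (Maybe Bool) (map (unfold L) cs) → Set
LeafBoundaries L cs τs = supps τs ≡ depthSets L (map (unfold L) cs)

LeafBoundary-suc : ∀ L s m τs → LeafBoundary (suc L) s (lnode m τs) → m ≡ nothing × LeafBoundaries L (children s) τs
LeafBoundary-suc L s nothing  τs eq = refl , cong lab-children eq
LeafBoundary-suc L s (just _) τs ()

module HardCore (λ' : ℚ) (0≤λ' : 0ℚ ≤ λ') where

  RatioIn-parent : ∀ {a b pa pb P₀ P} → 0ℚ ≤ a → 0ℚ ≤ b → 0ℚ ≤ pa →
    a * (1ℚ + λ' * pb) ≤ 1ℚ → 1ℚ ≤ b * (1ℚ + λ' * pa) → RatioIn pa pb P₀ P → RatioIn a b P (λ' * P₀ + P)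
  RatioIn-parent {a} {b} {pa} {pb} {P₀} {P} 0≤a 0≤b 0≤pa a-cond b-cond r@(ratioIn 0<P paP≤P₀ P₀≤pbP) =
    ratioIn (nonNeg+pos′ (nonNeg*nonNeg′ 0≤λ' (RatioIn-numerator-nonNeg 0≤pa r)) 0<P) lower-bound upper-bound
    where
    open ≤-Reasoning
    collect : ∀ l c q P → c * (l * (q * P) + P) ≡ (c * (1ℚ + l * q)) * P
    collect = solve-∀ ℚ-ring
    lower-bound : a * (λ' * P₀ + P) ≤ P
    lower-bound = begin
      a * (λ' * P₀ + P)       ≤⟨ *-monoˡ-≤-nonNeg′ 0≤a (+-monoˡ-≤ P (*-monoˡ-≤-nonNeg′ 0≤λ' P₀≤pbP)) ⟩
      a * (λ' * (pb * P) + P) ≡⟨ collect λ' a pb P ⟩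
      a * (1ℚ + λ' * pb) * P  ≤⟨ *-monoʳ-≤-nonNeg′ (<⇒≤ 0<P) a-cond ⟩
      1ℚ * P                  ≡⟨ *-identityˡ P ⟩
      P                       ∎
    upper-bound : P ≤ b * (λ' * P₀ + P)
    upper-bound = begin
      P                       ≡⟨ *-identityˡ P ⟨
      1ℚ * P                  ≤⟨ *-monoʳ-≤-nonNeg′ (<⇒≤ 0<P) b-cond ⟩
      b * (1ℚ + λ' * pa) * P  ≡⟨ collect λ' b pa P ⟨
      b * (λ' * (pa * P) + P) ≤⟨ *-monoˡ-≤-nonNeg′ 0≤b (+-monoˡ-≤ P (*-monoˡ-≤-nonNeg′ 0≤λ' paP≤P₀)) ⟩
      b * (λ' * P₀ + P)       ∎

  RatioGap-parent : ∀ {δ ε a b P₀ P Q₀ Q} → 0ℚ ≤ δ → 0ℚ ≤ a →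
    λ' * ε ≤ δ * ((1ℚ + λ' * a) * (1ℚ + λ' * a)) → RatioIn a b P₀ P → RatioIn a b Q₀ Q →
    RatioGap ε Q₀ Q P₀ P → RatioGap δ P (λ' * P₀ + P) Q (λ' * Q₀ + Q)
  RatioGap-parent {δ} {ε} {a} {b} {P₀} {P} {Q₀} {Q} 0≤δ 0≤a cond (ratioIn 0<P aP≤P₀ _) (ratioIn 0<Q aQ≤Q₀ _) gap = begin
    P * (λ' * Q₀ + Q) - Q * (λ' * P₀ + P)           ≡⟨ cross λ' P P₀ Q Q₀ ⟩
    λ' * (Q₀ * P - P₀ * Q)                          ≤⟨ *-monoˡ-≤-nonNeg′ 0≤λ' gap ⟩
    λ' * (ε * (Q * P))                              ≡⟨ *-assoc λ' ε (Q * P) ⟨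
    λ' * ε * (Q * P)                                ≤⟨ *-monoʳ-≤-nonNeg′ (nonNeg*nonNeg′ (<⇒≤ 0<Q) (<⇒≤ 0<P)) cond ⟩
    δ * ((1ℚ + λ' * a) * (1ℚ + λ' * a)) * (Q * P)   ≡⟨ regroup δ λ' a Q P ⟩
    δ * ((1ℚ + λ' * a) * P * ((1ℚ + λ' * a) * Q))   ≤⟨ *-monoˡ-≤-nonNeg′ 0≤δ (*-mono-≤-nonNeg′ (scaled-nonNeg 0<P) (scaled-nonNeg 0<Q)
                                                         (scaled-≤ aP≤P₀) (scaled-≤ aQ≤Q₀)) ⟩
    δ * ((λ' * P₀ + P) * (λ' * Q₀ + Q))             ∎
    where
    open ≤-Reasoning
    cross : ∀ l P P₀ Q Q₀ → P * (l * Q₀ + Q) - Q * (l * P₀ + P) ≡ l * (Q₀ * P - P₀ * Q)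
    cross = solve-∀ ℚ-ring
    regroup : ∀ δ l a Q P → δ * ((1ℚ + l * a) * (1ℚ + l * a)) * (Q * P) ≡ δ * ((1ℚ + l * a) * P * ((1ℚ + l * a) * Q))
    regroup = solve-∀ ℚ-ring
    expand : ∀ l a R → (1ℚ + l * a) * R ≡ l * (a * R) + R
    expand = solve-∀ ℚ-ring
    scaled-nonNeg : ∀ {R} → 0ℚ < R → 0ℚ ≤ (1ℚ + λ' * a) * R
    scaled-nonNeg 0<R = nonNeg*nonNeg′ (nonNeg+nonNeg′ (<⇒≤ (positive⁻¹ 1ℚ)) (nonNeg*nonNeg′ 0≤λ' 0≤a)) (<⇒≤ 0<R)
    scaled-≤ : ∀ {R₀ R} → a * R ≤ R₀ → (1ℚ + λ' * a) * R ≤ λ' * R₀ + R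
    scaled-≤ {R₀} {R} aR≤R₀ = ≤-trans (≤-reflexive (expand λ' a R)) (+-monoˡ-≤ R (*-monoˡ-≤-nonNeg′ 0≤λ' aR≤R₀))

  RatioGap-* : ∀ {a b a′ b′ δ ε z₀ z y₀ y Z₀ Z Y₀ Y} → 0ℚ ≤ a → 0ℚ ≤ a′ → 0ℚ ≤ δ → 0ℚ ≤ ε →
    RatioIn a b z₀ z → RatioIn a b y₀ y → RatioIn a′ b′ Z₀ Z → RatioIn a′ b′ Y₀ Y →
    RatioGap δ z₀ z y₀ y → RatioGap ε Z₀ Z Y₀ Y → RatioGap (δ * b′ + b * ε) (z₀ * Z₀) (z * Z) (y₀ * Y₀) (y * Y)
  RatioGap-* {a} {b} {a′} {b′} {δ} {ε} {z₀} {z} {y₀} {y} {Z₀} {Z} {Y₀} {Y}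
             0≤a 0≤a′ 0≤δ 0≤ε (ratioIn 0<z _ _) ry@(ratioIn 0<y _ y₀≤by) rZ@(ratioIn 0<Z _ Z₀≤b′Z) (ratioIn 0<Y _ _) gap gap′ = begin
    z₀ * Z₀ * (y * Y) - y₀ * Y₀ * (z * Z)                     ≡⟨ split z₀ Z₀ y Y y₀ Y₀ z Z ⟩
    (z₀ * y - y₀ * z) * (Z₀ * Y) + y₀ * z * (Z₀ * Y - Y₀ * Z) ≤⟨ +-mono-≤ first-factor other-factors ⟩
    δ * (z * y) * (b′ * Z * Y) + b * y * z * (ε * (Z * Y))    ≡⟨ collect δ b′ b ε z y Z Y ⟩
    (δ * b′ + b * ε) * (z * Z * (y * Y))                      ∎
    where
    open ≤-Reasoning
    first-factor : (z₀ * y - y₀ * z) * (Z₀ * Y) ≤ δ * (z * y) * (b′ * Z * Y)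
    first-factor = ≤-trans (*-monoʳ-≤-nonNeg′ (nonNeg*nonNeg′ (RatioIn-numerator-nonNeg 0≤a′ rZ) (<⇒≤ 0<Y)) gap)
      (*-monoˡ-≤-nonNeg′ (nonNeg*nonNeg′ 0≤δ (nonNeg*nonNeg′ (<⇒≤ 0<z) (<⇒≤ 0<y))) (*-monoʳ-≤-nonNeg′ (<⇒≤ 0<Y) Z₀≤b′Z))
    other-factors : y₀ * z * (Z₀ * Y - Y₀ * Z) ≤ b * y * z * (ε * (Z * Y))
    other-factors = ≤-trans (*-monoˡ-≤-nonNeg′ (nonNeg*nonNeg′ (RatioIn-numerator-nonNeg 0≤a ry) (<⇒≤ 0<z)) gap′)
      (*-monoʳ-≤-nonNeg′ (nonNeg*nonNeg′ 0≤ε (nonNeg*nonNeg′ (<⇒≤ 0<Z) (<⇒≤ 0<Y))) (*-monoʳ-≤-nonNeg′ (<⇒≤ 0<z) y₀≤by))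
    split : ∀ z₀ Z₀ y Y y₀ Y₀ z Z →
      z₀ * Z₀ * (y * Y) - y₀ * Y₀ * (z * Z) ≡ (z₀ * y - y₀ * z) * (Z₀ * Y) + y₀ * z * (Z₀ * Y - Y₀ * Z)
    split = solve-∀ ℚ-ring
    collect : ∀ δ b′ b ε z y Z Y → δ * (z * y) * (b′ * Z * Y) + b * y * z * (ε * (Z * Y)) ≡ (δ * b′ + b * ε) * (z * Z * (y * Y))
    collect = solve-∀ ℚ-ring

  module _ {S : Set} (tree : S → Tree) where

    AllRatioIn : (S → ℚ) → (S → ℚ) → (cs : List S) → Labs (Maybe Bool) (map tree cs) → Set
    AllRatioIn A B []       []       = ⊤
    AllRatioIn A B (c ∷ cs) (τ ∷ τs) = RatioIn (A c) (B c) (Zc0 λ' (tree c) τ) (Zc λ' (tree c) τ) × AllRatioIn A B cs τs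

    AllRatioGap : (S → ℚ) → (cs : List S) → (τs τs′ : Labs (Maybe Bool) (map tree cs)) → Set
    AllRatioGap δ []       []       []         = ⊤
    AllRatioGap δ (c ∷ cs) (τ ∷ τs) (τ′ ∷ τs′) =
      RatioGap (δ c) (Zc0 λ' (tree c) τ) (Zc λ' (tree c) τ) (Zc0 λ' (tree c) τ′) (Zc λ' (tree c) τ′) × AllRatioGap δ cs τs τs′

    RatioIn-prod : ∀ {A B} → (∀ c → 0ℚ ≤ A c) → ∀ cs τs → AllRatioIn A B cs τs →
      RatioIn (prodℚ A cs) (prodℚ B cs) (ΠZ0 λ' (map tree cs) τs) (ΠZ λ' (map tree cs) τs)
    RatioIn-prod 0≤A []       []       _        = ratioIn (positive⁻¹ 1ℚ) ≤-refl ≤-refl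
    RatioIn-prod 0≤A (c ∷ cs) (τ ∷ τs) (r , rs) = RatioIn-* (0≤A c) (prodℚ-nonNeg 0≤A cs) r (RatioIn-prod 0≤A cs τs rs)

    RatioGap-prod : ∀ {A B δ} → (∀ c → 0ℚ ≤ A c) → (∀ c → 0ℚ ≤ B c) → (∀ c → 0ℚ ≤ δ c) → ∀ cs τs τs′ →
      AllRatioIn A B cs τs → AllRatioIn A B cs τs′ → AllRatioGap δ cs τs τs′ →
      RatioGap (productGap δ B cs) (ΠZ0 λ' (map tree cs) τs) (ΠZ λ' (map tree cs) τs) (ΠZ0 λ' (map tree cs) τs′) (ΠZ λ' (map tree cs) τs′)
    RatioGap-prod 0≤A 0≤B 0≤δ []       []       []         _        _          _            = ≤-refl
    RatioGap-prod 0≤A 0≤B 0≤δ (c ∷ cs) (τ ∷ τs) (τ′ ∷ τs′) (r , rs) (r′ , rs′) (gap , gaps) =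
      RatioGap-* (0≤A c) (prodℚ-nonNeg 0≤A cs) (0≤δ c) (productGap-nonNeg 0≤δ 0≤B cs)
        r r′ (RatioIn-prod 0≤A cs τs rs) (RatioIn-prod 0≤A cs τs′ rs′) gap (RatioGap-prod 0≤A 0≤B 0≤δ cs τs τs′ rs rs′ gaps)

    RatioIn-free-root : ∀ {a b A B} cs τs → 0ℚ ≤ a → 0ℚ ≤ b → (∀ c → 0ℚ ≤ A c) →
      a * (1ℚ + λ' * prodℚ B cs) ≤ 1ℚ → 1ℚ ≤ b * (1ℚ + λ' * prodℚ A cs) → AllRatioIn A B cs τs →
      RatioIn a b (Zc0 λ' (node (map tree cs)) (lnode nothing τs)) (Zc λ' (node (map tree cs)) (lnode nothing τs))
    RatioIn-free-root cs τs 0≤a 0≤b 0≤A a-cond b-cond rs =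
      subst₂ (RatioIn _ _) (sym (Zc0-node λ' (map tree cs) nothing τs)) (sym (Zc-node λ' (map tree cs) nothing τs))
        (RatioIn-parent 0≤a 0≤b (prodℚ-nonNeg 0≤A cs) a-cond b-cond (RatioIn-prod 0≤A cs τs rs))

    RatioGap-free-root : ∀ {A B δ δ′} cs τs τs′ → (∀ c → 0ℚ ≤ A c) → (∀ c → 0ℚ ≤ B c) → (∀ c → 0ℚ ≤ δ c) → 0ℚ ≤ δ′ →
      λ' * productGap δ B cs ≤ δ′ * ((1ℚ + λ' * prodℚ A cs) * (1ℚ + λ' * prodℚ A cs)) →
      AllRatioIn A B cs τs → AllRatioIn A B cs τs′ → AllRatioGap δ cs τs′ τs →
      RatioGap δ′ (Zc0 λ' (node (map tree cs)) (lnode nothing τs)) (Zc λ' (node (map tree cs)) (lnode nothing τs))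
                  (Zc0 λ' (node (map tree cs)) (lnode nothing τs′)) (Zc λ' (node (map tree cs)) (lnode nothing τs′))
    RatioGap-free-root cs τs τs′ 0≤A 0≤B 0≤δ 0≤δ′ cond rs rs′ gaps
      rewrite Zc0-node λ' (map tree cs) nothing τs | Zc-node λ' (map tree cs) nothing τs
            | Zc0-node λ' (map tree cs) nothing τs′ | Zc-node λ' (map tree cs) nothing τs′ =
      RatioGap-parent 0≤δ′ (prodℚ-nonNeg 0≤A cs) cond (RatioIn-prod 0≤A cs τs rs) (RatioIn-prod 0≤A cs τs′ rs′)
        (RatioGap-prod 0≤A 0≤B 0≤δ cs τs′ τs rs′ rs gaps)

  RatioIn-unoccupied-leaf : ∀ {a b} → a ≤ 1ℚ → 1ℚ ≤ b →
    RatioIn a b (Zc0 λ' (node []) (lnode (just false) [])) (Zc λ' (node []) (lnode (just false) []))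
  RatioIn-unoccupied-leaf {a} {b} a≤1 1≤b =
    subst₂ (RatioIn a b) (sym (Zc0-node λ' [] (just false) [])) (sym (Zc-node λ' [] (just false) []))
      (ratioIn (positive⁻¹ 1ℚ) (≤-trans (≤-reflexive (*-identityʳ a)) a≤1) (≤-trans 1≤b (≤-reflexive (sym (*-identityʳ b)))))

  RatioIn-occupied-leaf : ∀ {a b} → 0ℚ < λ' → a ≤ 0ℚ → 0ℚ ≤ b →
    RatioIn a b (Zc0 λ' (node []) (lnode (just true) [])) (Zc λ' (node []) (lnode (just true) []))
  RatioIn-occupied-leaf {a} {b} 0<λ' a≤0 0≤b =
    subst₂ (RatioIn a b) (sym (Zc0-node λ' [] (just true) [])) (sym (trans (Zc-node λ' [] (just true) []) Z≡λ'))
      (ratioIn 0<λ' (≤-trans (*-monoʳ-≤-nonNeg′ 0≤λ' a≤0) (≤-reflexive (*-zeroˡ λ'))) (nonNeg*nonNeg′ 0≤b 0≤λ'))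
    where
    Z≡λ' : λ' * 1ℚ + 0ℚ ≡ λ'
    Z≡λ' = trans (+-identityʳ _) (*-identityʳ λ')

  RatioIn-unoccupied-root : ∀ ts τs → 0ℚ < ΠZ λ' ts τs →
    RatioIn 1ℚ 1ℚ (Zc0 λ' (node ts) (lnode (just false) τs)) (Zc λ' (node ts) (lnode (just false) τs))
  RatioIn-unoccupied-root ts τs 0<Π =
    subst₂ (RatioIn 1ℚ 1ℚ) (sym (Zc0-node λ' ts (just false) τs)) (sym (Zc-node λ' ts (just false) τs))
      (ratioIn (subst (0ℚ <_) (sym (+-identityˡ _)) 0<Π) (≤-reflexive (trans (*-identityˡ _) (+-identityˡ _)))
               (≤-reflexive (sym (trans (*-identityˡ _) (+-identityˡ _)))))

  RatioBounds : ℕ → (State → ℚ) → (State → ℚ) → Set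
  RatioBounds L A B = ∀ s τ → LeafBoundary L s τ → RatioIn (A s) (B s) (Zc0 λ' (unfold L s) τ) (Zc λ' (unfold L s) τ)

  RatioGaps : ℕ → (State → ℚ) → Set
  RatioGaps L δ = ∀ s τ τ′ → LeafBoundary L s τ → LeafBoundary L s τ′ →
    RatioGap (δ s) (Zc0 λ' (unfold L s) τ) (Zc λ' (unfold L s) τ) (Zc0 λ' (unfold L s) τ′) (Zc λ' (unfold L s) τ′)

  RatioBounds⇒AllRatioIn : ∀ {L A B} → RatioBounds L A B → ∀ cs τs → LeafBoundaries L cs τs → AllRatioIn (unfold L) A B cs τs
  RatioBounds⇒AllRatioIn bounds []       []       _  = tt
  RatioBounds⇒AllRatioIn bounds (c ∷ cs) (τ ∷ τs) eq =
    bounds c τ (cong labs-head eq) , RatioBounds⇒AllRatioIn bounds cs τs (cong labs-tail eq)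

  RatioGaps⇒AllRatioGap : ∀ {L δ} → RatioGaps L δ → ∀ cs τs τs′ → LeafBoundaries L cs τs → LeafBoundaries L cs τs′ →
    AllRatioGap (unfold L) δ cs τs τs′
  RatioGaps⇒AllRatioGap gaps []       []       []         _  _   = tt
  RatioGaps⇒AllRatioGap gaps (c ∷ cs) (τ ∷ τs) (τ′ ∷ τs′) eq eq′ =
    gaps c τ τ′ (cong labs-head eq) (cong labs-head eq′) , RatioGaps⇒AllRatioGap gaps cs τs τs′ (cong labs-tail eq) (cong labs-tail eq′)

  RatioBounds-leaves : ∀ {A B} → 0ℚ < λ' → (∀ s → A s ≤ 0ℚ) → (∀ s → 1ℚ ≤ B s) → RatioBounds 0 A B
  RatioBounds-leaves 0<λ' A≤0 1≤B s (lnode (just true)  []) _ = RatioIn-occupied-leaf 0<λ' (A≤0 s) (≤-trans (<⇒≤ (positive⁻¹ 1ℚ)) (1≤B s))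
  RatioBounds-leaves 0<λ' A≤0 1≤B s (lnode (just false) []) _ = RatioIn-unoccupied-leaf (≤-trans (A≤0 s) (<⇒≤ (positive⁻¹ 1ℚ))) (1≤B s)
  RatioBounds-leaves 0<λ' A≤0 1≤B s (lnode nothing      []) ()

  RatioBounds-suc : ∀ {L A B A′ B′} → (∀ s → 0ℚ ≤ A s) → (∀ s → 0ℚ ≤ A′ s) → (∀ s → 0ℚ ≤ B′ s) →
    (∀ s → A′ s * (1ℚ + λ' * prodℚ B (children s)) ≤ 1ℚ) → (∀ s → 1ℚ ≤ B′ s * (1ℚ + λ' * prodℚ A (children s))) →
    RatioBounds L A B → RatioBounds (suc L) A′ B′
  RatioBounds-suc {L} 0≤A 0≤A′ 0≤B′ A′-cond B′-cond bounds s (lnode m τs) lb with LeafBoundary-suc L s m τs lb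
  ... | refl , lbs = RatioIn-free-root (unfold L) (children s) τs (0≤A′ s) (0≤B′ s) 0≤A (A′-cond s) (B′-cond s)
                       (RatioBounds⇒AllRatioIn bounds (children s) τs lbs)

  RatioGaps-suc : ∀ {L A B δ δ′} → (∀ s → 0ℚ ≤ A s) → (∀ s → 0ℚ ≤ B s) → (∀ s → 0ℚ ≤ δ s) → (∀ s → 0ℚ ≤ δ′ s) →
    (∀ s → λ' * productGap δ B (children s) ≤ δ′ s * ((1ℚ + λ' * prodℚ A (children s)) * (1ℚ + λ' * prodℚ A (children s)))) →
    RatioBounds L A B → RatioGaps L δ → RatioGaps (suc L) δ′
  RatioGaps-suc {L} 0≤A 0≤B 0≤δ 0≤δ′ cond bounds gaps s (lnode m τs) (lnode m′ τs′) lb lb′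
    with LeafBoundary-suc L s m τs lb | LeafBoundary-suc L s m′ τs′ lb′
  ... | refl , lbs | refl , lbs′ =
    RatioGap-free-root (unfold L) (children s) τs τs′ 0≤A 0≤B 0≤δ (0≤δ′ s) (cond s)
      (RatioBounds⇒AllRatioIn bounds (children s) τs lbs) (RatioBounds⇒AllRatioIn bounds (children s) τs′ lbs′)
      (RatioGaps⇒AllRatioGap gaps (children s) τs′ τs lbs′ lbs)

  RatioBounds-unit : 0ℚ < λ' → ∀ L → RatioBounds L (λ _ → 0ℚ) (λ _ → 1ℚ)
  RatioBounds-unit 0<λ' zero    = RatioBounds-leaves 0<λ' (λ _ → ≤-refl) (λ _ → ≤-refl)
  RatioBounds-unit 0<λ' (suc L) =
    RatioBounds-suc (λ _ → ≤-refl) (λ _ → ≤-refl) (λ _ → 0≤1) (λ s → ≤-trans (≤-reflexive (*-zeroˡ (1ℚ + λ' * prodℚ (λ _ → 1ℚ) (children s)))) 0≤1)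
      (λ s → ≤-trans (1≤1+ (nonNeg*nonNeg′ 0≤λ' (prodℚ-nonNeg (λ _ → ≤-refl) (children s)))) (≤-reflexive (sym (*-identityˡ _))))
      (RatioBounds-unit 0<λ' L)
    where
    0≤1 : 0ℚ ≤ 1ℚ
    0≤1 = <⇒≤ (positive⁻¹ 1ℚ)
    1≤1+ : ∀ {x} → 0ℚ ≤ x → 1ℚ ≤ 1ℚ + x
    1≤1+ {x} 0≤x = ≤-trans (≤-reflexive (sym (+-identityʳ 1ℚ))) (+-monoʳ-≤ 1ℚ 0≤x)

·-nonNeg : ∀ {x} → 0ℚ ≤ x → ∀ n → 0ℚ ≤ n · x
·-nonNeg 0≤x zero    = ≤-refl
·-nonNeg 0≤x (suc n) = nonNeg+nonNeg′ 0≤x (·-nonNeg 0≤x n)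

·-monoʳ-≤ : ∀ {x y} → x ≤ y → ∀ n → n · x ≤ n · y
·-monoʳ-≤ x≤y zero    = ≤-refl
·-monoʳ-≤ x≤y (suc n) = +-mono-≤ x≤y (·-monoʳ-≤ x≤y n)

-- 1 / (d + 1), as the unnormalised mkℚᵘ 1 d
unitFraction : ℕ → ℚ
unitFraction d = fromℚᵘ (mkℚᵘ (+ 1) d)

·-unitFraction : ∀ d n → toℚᵘ (n · unitFraction d) ≃ mkℚᵘ (+ n) d
·-unitFraction d zero    = *≡* refl
·-unitFraction d (suc n) = ℚᵘ.≃-trans (toℚᵘ-homo-+ (unitFraction d) (n · unitFraction d))
  (ℚᵘ.≃-trans (ℚᵘ.+-cong (toℚᵘ-fromℚᵘ (mkℚᵘ (+ 1) d)) (·-unitFraction d n))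
    (*≡* (trans (cross (+ n) (+ suc d)) (cong₂ ℤ._*_ (sym (ℤ.pos-+ 1 n)) (sym (ℤ.pos-* (suc d) (suc d)))))))
  where
  cross : ∀ (n d : ℤ.ℤ) → (ℤ.1ℤ ℤ.* d ℤ.+ n ℤ.* d) ℤ.* d ≡ (ℤ.1ℤ ℤ.+ n) ℤ.* (d ℤ.* d)
  cross = ℤ-solve-∀

unitFraction-≤ : ∀ ε → 0ℚ < ε → unitFraction (ℚ.denominator-1 ε) ≤ ε
unitFraction-≤ (mkℚ +[1+ p ] d _) _ = toℚᵘ-cancel-≤ (ℚᵘ.≤-respˡ-≃ (ℚᵘ.≃-sym (toℚᵘ-fromℚᵘ (mkℚᵘ (+ 1) d)))
  (*≤* (ℤ.*-monoʳ-≤-nonNeg (+ suc d) {+ 1} {+[1+ p ]} (ℤ.+≤+ (s≤s z≤n)))))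
unitFraction-≤ (mkℚ (+ zero)  d _) (*<* (ℤ.+<+ ()))
unitFraction-≤ (mkℚ -[1+ n ]  d _) (*<* ())

archimedean : ∀ ε → 0ℚ < ε → 1ℚ ≤ suc (ℚ.denominator-1 ε) · ε
archimedean ε 0<ε = ≤-trans one≤ (·-monoʳ-≤ (unitFraction-≤ ε 0<ε) (suc d))
  where
  d = ℚ.denominator-1 ε
  one≤ : 1ℚ ≤ suc d · unitFraction d
  one≤ = toℚᵘ-cancel-≤ (ℚᵘ.≤-reflexive (ℚᵘ.≃-sym (ℚᵘ.≃-trans (·-unitFraction d (suc d)) (*≡* (ℤ.*-comm (+ suc d) (+ 1))))))

bernoulli : ∀ ε → 0ℚ ≤ ε → ε ≤ 1ℚ → ∀ n → (1ℚ - ε) ^ℚ n * (1ℚ + n · ε) ≤ 1ℚ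
bernoulli ε 0≤ε ε≤1 zero    = ≤-refl
bernoulli ε 0≤ε ε≤1 (suc n) = begin
  (1ℚ - ε) * (1ℚ - ε) ^ℚ n * (1ℚ + (ε + n · ε))            ≡⟨ expand ε ((1ℚ - ε) ^ℚ n) (n · ε) ⟩
  (1ℚ - ε) ^ℚ n * ((1ℚ + n · ε) - ε * (ε + n · ε))          ≤⟨ *-monoˡ-≤-nonNeg′ (^ℚ-nonNeg 0≤1-ε n) (p-q≤p (nonNeg*nonNeg′ 0≤ε (nonNeg+nonNeg′ 0≤ε (·-nonNeg 0≤ε n)))) ⟩
  (1ℚ - ε) ^ℚ n * (1ℚ + n · ε)                             ≤⟨ bernoulli ε 0≤ε ε≤1 n ⟩
  1ℚ                                                       ∎
  where
  open ≤-Reasoning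
  expand : ∀ e p t → (1ℚ - e) * p * (1ℚ + (e + t)) ≡ p * ((1ℚ + t) - e * (e + t))
  expand = solve-∀ ℚ-ring
  0≤1-ε : 0ℚ ≤ 1ℚ - ε
  0≤1-ε = subst (_≤ 1ℚ - ε) (+-inverseʳ ε) (+-monoˡ-≤ (- ε) ε≤1)

^ℚ-eventually-< : ∀ γ c → 0ℚ ≤ γ → γ < 1ℚ → 0ℚ < c → ∃[ n ] γ ^ℚ n < c
^ℚ-eventually-< γ c 0≤γ γ<1 0<c = n , *-cancelʳ-<-nonNeg R {{nonNegative 0≤R}} (begin-strict
  γ ^ℚ n * R                ≡⟨ cong (λ g → g ^ℚ n * R) (sym (1-[1-γ] γ)) ⟩
  (1ℚ - ε) ^ℚ n * R         ≤⟨ bernoulli ε (<⇒≤ 0<ε) ε≤1 n ⟩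
  1ℚ                        <⟨ 1<c+1 ⟩
  c + 1ℚ                    ≤⟨ +-monoʳ-≤ c 1≤c*nε ⟩
  c + c * (n · ε)           ≡⟨ distrib c (n · ε) ⟩
  c * R                     ∎)
  where
  open ≤-Reasoning
  ε = 1ℚ - γ
  k = suc (ℚ.denominator-1 ε)
  m = suc (ℚ.denominator-1 c)
  n = m ℕ.* k
  R = 1ℚ + n · ε
  1-[1-γ] : ∀ γ → 1ℚ - (1ℚ - γ) ≡ γ
  1-[1-γ] = solve-∀ ℚ-ring
  distrib : ∀ c x → c + c * x ≡ c * (1ℚ + x)
  distrib = solve-∀ ℚ-ring
  0<ε : 0ℚ < ε
  0<ε = subst (_< ε) (+-inverseʳ γ) (+-monoˡ-< (- γ) γ<1)
  ε≤1 : ε ≤ 1ℚ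
  ε≤1 = p-q≤p 0≤γ
  0≤R : 0ℚ ≤ R
  0≤R = nonNeg+nonNeg′ (<⇒≤ (positive⁻¹ 1ℚ)) (·-nonNeg (<⇒≤ 0<ε) n)
  1<c+1 : 1ℚ < c + 1ℚ
  1<c+1 = subst (_< c + 1ℚ) (+-identityˡ 1ℚ) (+-monoˡ-< 1ℚ 0<c)
  1≤c*nε : 1ℚ ≤ c * (n · ε)
  1≤c*nε = begin
    1ℚ               ≤⟨ archimedean c 0<c ⟩
    m · c            ≡⟨ cong (m ·_) (*-identityʳ c) ⟨
    m · (c * 1ℚ)     ≡⟨ ×-comm-* m c 1ℚ ⟨
    c * (m · 1ℚ)     ≤⟨ *-monoˡ-≤-nonNeg′ (<⇒≤ 0<c) (·-monoʳ-≤ (archimedean ε 0<ε) m) ⟩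
    c * (m · k · ε)  ≡⟨ cong (c *_) (×-assocˡ ε m k) ⟩
    c * (n · ε)      ∎

index : State → Fin 17
index O   = # 0
index N   = # 1
index E   = # 2
index W   = # 3
index NN  = # 4
index NNE = # 5
index NEE = # 6
index EES = # 7
index ESE = # 8
index SEE = # 9
index EEN = # 10
index NNW = # 11
index NWW = # 12
index WWS = # 13
index WSW = # 14
index SWW = # 15
index WWN = # 16

stateAt : Fin 17 → State
stateAt = lookup (O ∷ N ∷ E ∷ W ∷ NN ∷ NNE ∷ NEE ∷ EES ∷ ESE ∷ SEE ∷ EEN ∷ NNW ∷ NWW ∷ WWS ∷ WSW ∷ SWW ∷ WWN ∷ [])

stateAt-index : ∀ s → stateAt (index s) ≡ s
stateAt-index O   = refl
stateAt-index N   = refl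
stateAt-index E   = refl
stateAt-index W   = refl
stateAt-index NN  = refl
stateAt-index NNE = refl
stateAt-index NEE = refl
stateAt-index EES = refl
stateAt-index ESE = refl
stateAt-index SEE = refl
stateAt-index EEN = refl
stateAt-index NNW = refl
stateAt-index NWW = refl
stateAt-index WWS = refl
stateAt-index WSW = refl
stateAt-index SWW = refl
stateAt-index WWN = refl

allStates : (State → Bool) → Bool
allStates f = all (f ∘ stateAt) (allFin 17)

allStates-sound : ∀ f → T (allStates f) → ∀ s → T (f s)
allStates-sound f ok s = subst (T ∘ f) (stateAt-index s) (All-lookup (all⁺ (f ∘ stateAt) (allFin 17) ok) (∈-allFin (index s)))

T-∧⁻ : ∀ a {b} → T (a ∧ b) → T a × T b
T-∧⁻ a = Equivalence.to (T-∧ {a})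

true⇒T : ∀ {b} → b ≡ true → T b
true⇒T refl = tt

Table : Set
Table = Vec ℕ 17

tabulateStates : (State → ℕ) → Table
tabulateStates f = tabulate (f ∘ stateAt)

_!_ : Table → State → ℕ
v ! s = lookup v (index s)

tabulateStates-! : ∀ f s → tabulateStates f ! s ≡ f s
tabulateStates-! f s = trans (lookup∘tabulate (f ∘ stateAt) (index s)) (cong f (stateAt-index s))

infixl 6 _+ₑ_
infixl 7 _*ₑ_
infix  4 _≤ₑ_

-- Certificates are checked in unnormalised rationals (no gcd computations); ⟦_⟧ᵘ agrees with ⟦_⟧ up to ≃.
data Expr : Set where
  num           : ℚᵘ → Expr
  rat           : ℚ → Expr
  λₑ oneₑ zeroₑ : Expr
  _+ₑ_ _*ₑ_     : Expr → Expr → Expr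

-- Opaque so that the type checker never normalises the large literals of a certificate.
opaque
  fromℚᵘ′ : ℚᵘ → ℚ
  fromℚᵘ′ = fromℚᵘ

  toℚᵘ-fromℚᵘ′ : ∀ u → toℚᵘ (fromℚᵘ′ u) ≃ u
  toℚᵘ-fromℚᵘ′ = toℚᵘ-fromℚᵘ

⟦_⟧ : Expr → ℚ
⟦ num u ⟧  = fromℚᵘ′ u
⟦ rat q ⟧  = q
⟦ λₑ ⟧     = λ₀
⟦ oneₑ ⟧   = 1ℚ
⟦ zeroₑ ⟧  = 0ℚ
⟦ e +ₑ f ⟧ = ⟦ e ⟧ + ⟦ f ⟧
⟦ e *ₑ f ⟧ = ⟦ e ⟧ * ⟦ f ⟧

⟦_⟧ᵘ : Expr → ℚᵘ
⟦ num u ⟧ᵘ  = u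
⟦ rat q ⟧ᵘ  = toℚᵘ q
⟦ λₑ ⟧ᵘ     = mkℚᵘ (+ 31) 9
⟦ oneₑ ⟧ᵘ   = ℚᵘ.1ℚᵘ
⟦ zeroₑ ⟧ᵘ  = ℚᵘ.0ℚᵘ
⟦ e +ₑ f ⟧ᵘ = ⟦ e ⟧ᵘ ℚᵘ.+ ⟦ f ⟧ᵘ
⟦ e *ₑ f ⟧ᵘ = ⟦ e ⟧ᵘ ℚᵘ.* ⟦ f ⟧ᵘ

toℚᵘ-⟦⟧ : ∀ e → toℚᵘ ⟦ e ⟧ ≃ ⟦ e ⟧ᵘ
toℚᵘ-⟦⟧ (num u)  = toℚᵘ-fromℚᵘ′ u
toℚᵘ-⟦⟧ (rat q)  = ℚᵘ.≃-refl
toℚᵘ-⟦⟧ λₑ       = *≡* refl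
toℚᵘ-⟦⟧ oneₑ     = *≡* refl
toℚᵘ-⟦⟧ zeroₑ    = *≡* refl
toℚᵘ-⟦⟧ (e +ₑ f) = ℚᵘ.≃-trans (toℚᵘ-homo-+ ⟦ e ⟧ ⟦ f ⟧) (ℚᵘ.+-cong (toℚᵘ-⟦⟧ e) (toℚᵘ-⟦⟧ f))
toℚᵘ-⟦⟧ (e *ₑ f) = ℚᵘ.≃-trans (toℚᵘ-homo-* ⟦ e ⟧ ⟦ f ⟧) (ℚᵘ.*-cong (toℚᵘ-⟦⟧ e) (toℚᵘ-⟦⟧ f))

opaque
  _≤ₑ_ : Expr → Expr → Bool
  e ≤ₑ f = ⟦ e ⟧ᵘ ℚᵘ.≤ᵇ ⟦ f ⟧ᵘ

  ≤ₑ-sound : ∀ e f → T (e ≤ₑ f) → ⟦ e ⟧ ≤ ⟦ f ⟧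
  ≤ₑ-sound e f ok = toℚᵘ-cancel-≤ (ℚᵘ.≤-respˡ-≃ (ℚᵘ.≃-sym (toℚᵘ-⟦⟧ e)) (ℚᵘ.≤-respʳ-≃ (ℚᵘ.≃-sym (toℚᵘ-⟦⟧ f)) (ℚᵘ.≤ᵇ⇒≤ ok)))

num-nonNeg : ∀ n d → 0ℚ ≤ ⟦ num (mkℚᵘ (+ n) d) ⟧
num-nonNeg n d = toℚᵘ-cancel-≤ (ℚᵘ.≤-respʳ-≃ (ℚᵘ.≃-sym (toℚᵘ-⟦⟧ (num (mkℚᵘ (+ n) d)))) (ℚᵘ.nonNegative⁻¹ _))

prodₑ : (State → Expr) → List State → Expr
prodₑ f []       = oneₑ
prodₑ f (c ∷ cs) = f c *ₑ prodₑ f cs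

⟦prodₑ⟧ : ∀ f cs → ⟦ prodₑ f cs ⟧ ≡ prodℚ (⟦_⟧ ∘ f) cs
⟦prodₑ⟧ f []       = refl
⟦prodₑ⟧ f (c ∷ cs) = cong (⟦ f c ⟧ *_) (⟦prodₑ⟧ f cs)

productGapₑ : (State → Expr) → (State → Expr) → List State → Expr
productGapₑ δ B []       = zeroₑ
productGapₑ δ B (c ∷ cs) = δ c *ₑ prodₑ B cs +ₑ B c *ₑ productGapₑ δ B cs

⟦productGapₑ⟧ : ∀ δ B cs → ⟦ productGapₑ δ B cs ⟧ ≡ productGap (⟦_⟧ ∘ δ) (⟦_⟧ ∘ B) cs
⟦productGapₑ⟧ δ B []       = refl
⟦productGapₑ⟧ δ B (c ∷ cs) rewrite ⟦prodₑ⟧ B cs | ⟦productGapₑ⟧ δ B cs = refl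

0<λ₀ : 0ℚ < λ₀
0<λ₀ = toWitness {a? = 0ℚ <? λ₀} tt

open HardCore λ₀ (<⇒≤ 0<λ₀)

-- Opaque: otherwise unification may normalise γ ^ℚ 1000 in ℚ.
opaque
  γ : ℚ
  γ = + 499 / 500

  0<γ : 0ℚ < γ
  0<γ = toWitness {a? = 0ℚ <? γ} tt

  γ<1 : γ < 1ℚ
  γ<1 = toWitness {a? = γ <? 1ℚ} tt

-- fixed-point numbers: fixed n stands for n / 2⁵⁰
unit : ℕ
unit = 1125899906842624

fixed : ℕ → Expr
fixed n = num (mkℚᵘ (+ n) (unit ℕ.∸ 1))

fixed-nonNeg : ∀ n → 0ℚ ≤ ⟦ fixed n ⟧
fixed-nonNeg n = num-nonNeg n (unit ℕ.∸ 1)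

record Bounds : Set where
  constructor bounds
  field
    lower upper : Table
    width       : ℕ
open Bounds public

lowerₑ upperₑ : Bounds → State → Expr
lowerₑ x s = fixed (lower x ! s)
upperₑ x s = fixed (upper x ! s)

lowerℚ upperℚ : Bounds → State → ℚ
lowerℚ x s = ⟦ lowerₑ x s ⟧
upperℚ x s = ⟦ upperₑ x s ⟧

-- One step of p ↦ 1 / (1 + λ ∏ p_c) in fixed point, rounded outwards. Nothing is proved about it:
-- the intervals it produces are verified by stepValid.
refine : Bounds → Bounds
refine (bounds lo hi w) = bounds (tabulateStates (reciprocal hi 0)) (tabulateStates (reciprocal lo 2)) ((w ℕ.* 499) ℕ./ 500)
  where
  prodT : Table → List State → ℕ
  prodT v []       = 1
  prodT v (c ∷ cs) = v ! c ℕ.* prodT v cs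
  reciprocal : Table → ℕ → State → ℕ
  reciprocal v slack s = slack ℕ.+ (10 ℕ.* unit ℕ.^ suc k) ℕ./ suc (10 ℕ.* unit ℕ.^ k ℕ.+ 31 ℕ.* prodT v (children s))
    where k = length (children s)

refineⁿ : ℕ → Bounds → Bounds
refineⁿ zero    x = x
refineⁿ (suc n) x = refineⁿ n (refine x)

initial final : Bounds
initial = bounds (tabulateStates (λ _ → 0)) (tabulateStates (λ _ → unit)) unit
final   = refineⁿ 1000 initial

lowerValid upperValid : Bounds → Bounds → State → Bool
lowerValid x x′ s = lowerₑ x′ s *ₑ (oneₑ +ₑ λₑ *ₑ prodₑ (upperₑ x) (children s)) ≤ₑ oneₑ
upperValid x x′ s = oneₑ ≤ₑ upperₑ x′ s *ₑ (oneₑ +ₑ λₑ *ₑ prodₑ (lowerₑ x) (children s))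

stepValid : Bounds → Bounds → Bool
stepValid x x′ = allStates (lowerValid x x′) ∧ allStates (upperValid x x′)

widthValid : Bounds → Bool
widthValid x = upperₑ x O ≤ₑ lowerₑ x O +ₑ fixed (width x)

decayValid : Bounds → Bounds → Bool
decayValid x x′ = fixed (width x′) ≤ₑ rat γ *ₑ fixed (width x)

certified : ℕ → Bounds → Bool
certified zero    x = widthValid x
certified (suc n) x = (widthValid x ∧ stepValid x (refine x) ∧ decayValid x (refine x)) ∧ certified n (refine x)

-- weights of the contraction argument, found numerically (any weights passing `contracts` would do)
potential : State → ℕ
potential O   = 1000000000
potential N   = 952417958
potential E   = 749451459
potential W   = 749451459
potential NN  = 808894293
potential NNE = 598734888
potential NEE = 682153622
potential EES = 122571087
potential ESE = 227019981
potential SEE = 357634626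
potential EEN = 749451459
potential NNW = 598734888
potential NWW = 682153622
potential WWS = 122571087
potential WSW = 227019981
potential SWW = 357634626
potential WWN = 749451459

potentialₑ : State → Expr
potentialₑ s = num (mkℚᵘ (+ potential s) 999999999)

potentialℚ : State → ℚ
potentialℚ s = ⟦ potentialₑ s ⟧

potential-nonNeg : ∀ s → 0ℚ ≤ potentialℚ s
potential-nonNeg s = num-nonNeg (potential s) 999999999

contracts : Bounds → State → Bool
contracts x s = λₑ *ₑ productGapₑ potentialₑ (upperₑ x) (children s) ≤ₑ rat γ *ₑ potentialₑ s *ₑ (D *ₑ D)
  where D = oneₑ +ₑ λₑ *ₑ prodₑ (lowerₑ x) (children s)

narrow : Bounds → State → Bool
narrow x s = upperₑ x s ≤ₑ lowerₑ x s +ₑ fixed (width x) *ₑ potentialₑ s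

-- The long computations are stated as equations b ≡ true and turned into T b outside the block:
-- proving T b directly here makes the type checker normalise b repeatedly.
opaque
  unfolding _≤ₑ_ γ
  initial-checks : T (fixed 0 ≤ₑ zeroₑ) × T (oneₑ ≤ₑ fixed unit) × T (fixed unit ≤ₑ oneₑ) × T (potentialₑ O ≤ₑ oneₑ)
  initial-checks = tt , tt , tt , tt

  certified-1000-≡ : certified 1000 initial ≡ true
  certified-1000-≡ = refl

  final-step-≡ : stepValid final final ≡ true
  final-step-≡ = refl

  final-contracts-≡ : allStates (contracts final) ≡ true
  final-contracts-≡ = refl

  final-narrow-≡ : allStates (narrow final) ≡ true
  final-narrow-≡ = refl

stepValid-sound : ∀ {L} x x′ → T (stepValid x x′) →
  RatioBounds L (lowerℚ x) (upperℚ x) → RatioBounds (suc L) (lowerℚ x′) (upperℚ x′)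
stepValid-sound x x′ ok =
  RatioBounds-suc (fixed-nonNeg ∘ (lower x !_)) (fixed-nonNeg ∘ (lower x′ !_)) (fixed-nonNeg ∘ (upper x′ !_)) lower-cond upper-cond
  where
  checks = T-∧⁻ (allStates (lowerValid x x′)) ok
  lower-cond : ∀ s → lowerℚ x′ s * (1ℚ + λ₀ * prodℚ (upperℚ x) (children s)) ≤ 1ℚ
  lower-cond s = subst (λ p → lowerℚ x′ s * (1ℚ + λ₀ * p) ≤ 1ℚ) (⟦prodₑ⟧ (upperₑ x) (children s))
    (≤ₑ-sound _ _ (allStates-sound (lowerValid x x′) (proj₁ checks) s))
  upper-cond : ∀ s → 1ℚ ≤ upperℚ x′ s * (1ℚ + λ₀ * prodℚ (lowerℚ x) (children s))
  upper-cond s = subst (λ p → 1ℚ ≤ upperℚ x′ s * (1ℚ + λ₀ * p)) (⟦prodₑ⟧ (lowerₑ x) (children s))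
    (≤ₑ-sound _ _ (allStates-sound (upperValid x x′) (proj₂ checks) s))

Invariant : Bounds → ℕ → Set
Invariant x L = RatioBounds L (lowerℚ x) (upperℚ x) × ⟦ fixed (width x) ⟧ ≤ γ ^ℚ L

initial-invariant : Invariant initial 0
initial-invariant = RatioBounds-leaves 0<λ₀ lower≤0 1≤upper , ≤ₑ-sound _ _ (proj₁ (proj₂ (proj₂ initial-checks)))
  where
  lower≤0 : ∀ s → lowerℚ initial s ≤ 0ℚ
  lower≤0 s = subst (λ n → ⟦ fixed n ⟧ ≤ 0ℚ) (sym (tabulateStates-! (λ _ → 0) s)) (≤ₑ-sound _ _ (proj₁ initial-checks))
  1≤upper : ∀ s → 1ℚ ≤ upperℚ initial s
  1≤upper s = subst (λ n → 1ℚ ≤ ⟦ fixed n ⟧) (sym (tabulateStates-! (λ _ → unit) s)) (≤ₑ-sound _ _ (proj₁ (proj₂ initial-checks)))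

certified-sound : ∀ n x L → T (certified n x) → Invariant x L →
  ∀ j → j ℕ.≤ n → Invariant (refineⁿ j x) (j ℕ.+ L) × T (widthValid (refineⁿ j x))
certified-sound zero    x L ok inv .zero z≤n = inv , ok
certified-sound (suc n) x L ok inv zero z≤n = inv , proj₁ (T-∧⁻ (widthValid x) (proj₁ (T-∧⁻ _ ok)))
certified-sound (suc n) x L ok (bounds-ok , width-ok) (suc j) (s≤s j≤n) =
  subst (λ L′ → Invariant (refineⁿ j (refine x)) L′ × T (widthValid (refineⁿ j (refine x)))) (ℕ.+-suc j L)
    (certified-sound n (refine x) (suc L) (proj₂ checks) (stepValid-sound x (refine x) (proj₁ step-decay) bounds-ok , width-decays) j j≤n)
  where
  checks = T-∧⁻ (widthValid x ∧ stepValid x (refine x) ∧ decayValid x (refine x)) ok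
  step-decay = T-∧⁻ (stepValid x (refine x)) (proj₂ (T-∧⁻ (widthValid x) (proj₁ checks)))
  width-decays : ⟦ fixed (width (refine x)) ⟧ ≤ γ * γ ^ℚ L
  width-decays = ≤-trans (≤ₑ-sound _ _ (proj₂ step-decay)) (*-monoˡ-≤-nonNeg′ (<⇒≤ 0<γ) width-ok)

invariant-upto-1000 : ∀ L → L ℕ.≤ 1000 → Invariant (refineⁿ L initial) L × T (widthValid (refineⁿ L initial))
invariant-upto-1000 L L≤1000 =
  subst (λ L′ → Invariant (refineⁿ L initial) L′ × T (widthValid (refineⁿ L initial))) (ℕ.+-identityʳ L)
    (certified-sound 1000 initial 0 (true⇒T certified-1000-≡) initial-invariant L L≤1000)

final-bounds : ∀ i → RatioBounds (i ℕ.+ 1000) (lowerℚ final) (upperℚ final)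
final-bounds zero    = proj₁ (proj₁ (invariant-upto-1000 1000 ℕ.≤-refl))
final-bounds (suc i) = stepValid-sound final final (true⇒T final-step-≡) (final-bounds i)

gapBound : ℕ → State → ℚ
gapBound L s = γ ^ℚ L * potentialℚ s

gapBound-nonNeg : ∀ L s → 0ℚ ≤ gapBound L s
gapBound-nonNeg L s = nonNeg*nonNeg′ (^ℚ-nonNeg (<⇒≤ 0<γ) L) (potential-nonNeg s)

contraction : ∀ L s → λ₀ * productGap (gapBound L) (upperℚ final) (children s)
  ≤ gapBound (suc L) s * ((1ℚ + λ₀ * prodℚ (lowerℚ final) (children s)) * (1ℚ + λ₀ * prodℚ (lowerℚ final) (children s)))
contraction L s = begin
  λ₀ * productGap (gapBound L) (upperℚ final) cs          ≡⟨ cong (λ₀ *_) (productGap-*ˡ (γ ^ℚ L) potentialℚ (upperℚ final) cs) ⟩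
  λ₀ * (γ ^ℚ L * productGap potentialℚ (upperℚ final) cs) ≡⟨ swap λ₀ (γ ^ℚ L) _ ⟩
  γ ^ℚ L * (λ₀ * productGap potentialℚ (upperℚ final) cs) ≤⟨ *-monoˡ-≤-nonNeg′ (^ℚ-nonNeg (<⇒≤ 0<γ) L) checked ⟩
  γ ^ℚ L * (γ * potentialℚ s * (D * D))                   ≡⟨ regroup (γ ^ℚ L) γ (potentialℚ s) (D * D) ⟩
  gapBound (suc L) s * (D * D)                            ∎
  where
  open ≤-Reasoning
  cs = children s
  D = 1ℚ + λ₀ * prodℚ (lowerℚ final) cs
  swap : ∀ l k g → l * (k * g) ≡ k * (l * g)
  swap = solve-∀ ℚ-ring
  regroup : ∀ k g v d → k * (g * v * d) ≡ g * k * v * d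
  regroup = solve-∀ ℚ-ring
  checked : λ₀ * productGap potentialℚ (upperℚ final) cs ≤ γ * potentialℚ s * (D * D)
  checked = subst₂ (λ g p → λ₀ * g ≤ γ * potentialℚ s * ((1ℚ + λ₀ * p) * (1ℚ + λ₀ * p)))
              (⟦productGapₑ⟧ potentialₑ (upperₑ final) cs) (⟦prodₑ⟧ (lowerₑ final) cs)
              (≤ₑ-sound _ _ (allStates-sound (contracts final) (true⇒T final-contracts-≡) s))

final-gaps : ∀ i → RatioGaps (i ℕ.+ 1000) (gapBound (i ℕ.+ 1000))
final-gaps zero    s τ τ′ lb lb′ = RatioIn⇒RatioGap narrowed (final-bounds 0 s τ lb) (final-bounds 0 s τ′ lb′)
  where
  narrowed : upperℚ final s ≤ lowerℚ final s + gapBound 1000 s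
  narrowed = ≤-trans (≤ₑ-sound _ _ (allStates-sound (narrow final) (true⇒T final-narrow-≡) s))
    (+-monoʳ-≤ (lowerℚ final s) (*-monoʳ-≤-nonNeg′ (potential-nonNeg s) (proj₂ (proj₁ (invariant-upto-1000 1000 ℕ.≤-refl)))))
final-gaps (suc i) =
  RatioGaps-suc (fixed-nonNeg ∘ (lower final !_)) (fixed-nonNeg ∘ (upper final !_)) (gapBound-nonNeg (i ℕ.+ 1000))
    (gapBound-nonNeg (suc i ℕ.+ 1000)) (contraction (i ℕ.+ 1000)) (final-bounds i) (final-gaps i)

pRoot-drift-early : ∀ L → L ℕ.≤ 1000 → ∀ τ₁ τ₂ → LeafBoundary L O τ₁ → LeafBoundary L O τ₂ →
  pRoot λ₀ (TD' L) τ₁ - pRoot λ₀ (TD' L) τ₂ ≤ γ ^ℚ L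
pRoot-drift-early L L≤1000 τ₁ τ₂ lb₁ lb₂ =
  x-y≤width (proj₂ (RatioIn⇒pRoot-bounds (TD' L) τ₁ (bounds-ok O τ₁ lb₁)))
            (proj₁ (RatioIn⇒pRoot-bounds (TD' L) τ₂ (bounds-ok O τ₂ lb₂)))
            (≤-trans (≤ₑ-sound _ _ (proj₂ inv)) (+-monoʳ-≤ (lowerℚ x O) (proj₂ (proj₁ inv))))
  where
  x = refineⁿ L initial
  inv = invariant-upto-1000 L L≤1000
  bounds-ok : RatioBounds L (lowerℚ x) (upperℚ x)
  bounds-ok = proj₁ (proj₁ inv)

pRoot-drift-late : ∀ i τ₁ τ₂ → LeafBoundary (i ℕ.+ 1000) O τ₁ → LeafBoundary (i ℕ.+ 1000) O τ₂ →
  pRoot λ₀ (TD' (i ℕ.+ 1000)) τ₁ - pRoot λ₀ (TD' (i ℕ.+ 1000)) τ₂ ≤ γ ^ℚ (i ℕ.+ 1000)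
pRoot-drift-late i τ₁ τ₂ lb₁ lb₂ = ≤-trans
  (RatioGap⇒pRoot-≤ (TD' (i ℕ.+ 1000)) τ₁ τ₂ (denominator-pos (final-bounds i O τ₁ lb₁)) (denominator-pos (final-bounds i O τ₂ lb₂))
     (final-gaps i O τ₁ τ₂ lb₁ lb₂))
  (≤-trans (*-monoˡ-≤-nonNeg′ (^ℚ-nonNeg (<⇒≤ 0<γ) (i ℕ.+ 1000)) (≤ₑ-sound _ _ (proj₂ (proj₂ (proj₂ initial-checks)))))
           (≤-reflexive (*-identityʳ _)))

pRoot-drift : ∀ L τ₁ τ₂ → LeafBoundary L O τ₁ → LeafBoundary L O τ₂ → pRoot λ₀ (TD' L) τ₁ - pRoot λ₀ (TD' L) τ₂ ≤ γ ^ℚ L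
pRoot-drift L with L ℕ.≤? 1000
... | yes L≤1000 = pRoot-drift-early L L≤1000
... | no  L≰1000 = subst (λ L → ∀ τ₁ τ₂ → LeafBoundary L O τ₁ → LeafBoundary L O τ₂ →
                                  pRoot λ₀ (TD' L) τ₁ - pRoot λ₀ (TD' L) τ₂ ≤ γ ^ℚ L)
                         (ℕ.m∸n+n≡m (ℕ.<⇒≤ (ℕ.≰⇒> L≰1000))) (pRoot-drift-late (L ℕ.∸ 1000))

wsm : WSM λ₀ TD'
wsm = γ , 0<γ , γ<1 , λ L τ₁ τ₂ lb₁ lb₂ →
  ∣x-y∣≤ (pRoot λ₀ (TD' L) τ₁) (pRoot λ₀ (TD' L) τ₂) (pRoot-drift L τ₁ τ₂ lb₁ lb₂) (pRoot-drift L τ₂ τ₁ lb₂ lb₁)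

mutual
  subsetB-refl : ∀ {t} (S : Lab Bool t) → subsetB S S ≡ true
  subsetB-refl (lnode false ss) = subsetsB-refl ss
  subsetB-refl (lnode true  ss) = subsetsB-refl ss

  subsetsB-refl : ∀ {ts} (S : Labs Bool ts) → subsetsB S S ≡ true
  subsetsB-refl []       = refl
  subsetsB-refl (s ∷ ss) = cong₂ _∧_ (subsetB-refl s) (subsetsB-refl ss)

eqMB-refl : ∀ x → eqMB x x ≡ true
eqMB-refl nothing      = refl
eqMB-refl (just true)  = refl
eqMB-refl (just false) = refl

mutual
  agreeOff-refl : ∀ {t} (S : Lab Bool t) (τ : PConf t) → agreeOff S τ τ ≡ true
  agreeOff-refl (lnode s ss) (lnode x xs) = cong₂ _∧_ (trans (cong (s ∨_) (eqMB-refl x)) (∨-zeroʳ s)) (agreeOffs-refl ss xs)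

  agreeOffs-refl : ∀ {ts} (S : Labs Bool ts) (τs : Labs (Maybe Bool) ts) → agreeOffs S τs τs ≡ true
  agreeOffs-refl []       []       = refl
  agreeOffs-refl (s ∷ ss) (x ∷ xs) = cong₂ _∧_ (agreeOff-refl s x) (agreeOffs-refl ss xs)

has-children : ∀ s → T (not (null (children s)))
has-children = allStates-sound (not ∘ null ∘ children) tt

mutual
  distRoot-depthSet : ∀ L s → distRoot (depthSet L (unfold L s)) ≡ just L
  distRoot-depthSet zero    s = refl
  distRoot-depthSet (suc L) s = cong (Maybe.map suc) (distRoots-depthSets L (children s) (has-children s))

  distRoots-depthSets : ∀ L cs → T (not (null cs)) → distRoots (depthSets L (map (unfold L) cs)) ≡ just L
  distRoots-depthSets L (c ∷ [])      _ = cong (λ m → minM m nothing) (distRoot-depthSet L c)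
  distRoots-depthSets L (c ∷ c′ ∷ cs) _ =
    trans (cong₂ minM (distRoot-depthSet L c) (distRoots-depthSets L (c′ ∷ cs) tt)) (cong just (ℕ.⊓-idem L))

mutual
  leafConf : (L : ℕ) → Bool → (s : State) → PConf (unfold L s)
  leafConf zero    b s = lnode (just b) []
  leafConf (suc L) b s = lnode nothing (leafConfs L b (children s))

  leafConfs : (L : ℕ) → Bool → (cs : List State) → Labs (Maybe Bool) (map (unfold L) cs)
  leafConfs L b []       = []
  leafConfs L b (c ∷ cs) = leafConf L b c ∷ leafConfs L b cs

mutual
  leafConf-boundary : ∀ L b s → LeafBoundary L s (leafConf L b s)
  leafConf-boundary zero    b s = refl
  leafConf-boundary (suc L) b s = cong (lnode false) (leafConfs-boundary L b (children s))

  leafConfs-boundary : ∀ L b cs → LeafBoundaries L cs (leafConfs L b cs)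
  leafConfs-boundary L b []       = refl
  leafConfs-boundary L b (c ∷ cs) = cong₂ _∷_ (leafConf-boundary L b c) (leafConfs-boundary L b cs)

-- Pinning the EES and WWS vertices unoccupied cuts the tree down to one on which the model has two phases.
isCut : State → Bool
isCut EES = true
isCut WWS = true
isCut _   = false

-- The last argument is isCut s, made explicit so that proofs can split on it.
mutual
  cutConfAt : (L : ℕ) → Bool → (s : State) → Bool → PConf (unfold L s)
  cutConfAt zero    b s true  = lnode (just false) []
  cutConfAt zero    b s false = lnode (just b) []
  cutConfAt (suc L) b s true  = lnode (just false) (leafConfs L false (children s))
  cutConfAt (suc L) b s false = lnode nothing (cutConfs L b (children s))

  cutConf : (L : ℕ) → Bool → (s : State) → PConf (unfold L s)
  cutConf L b s = cutConfAt L b s (isCut s)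

  cutConfs : (L : ℕ) → Bool → (cs : List State) → Labs (Maybe Bool) (map (unfold L) cs)
  cutConfs L b []       = []
  cutConfs L b (c ∷ cs) = cutConf L b c ∷ cutConfs L b cs

mutual
  supp-cutConfAt : ∀ L s d → supp (cutConfAt L true s d) ≡ supp (cutConfAt L false s d)
  supp-cutConfAt zero    s true  = refl
  supp-cutConfAt zero    s false = refl
  supp-cutConfAt (suc L) s true  = refl
  supp-cutConfAt (suc L) s false = cong (lnode false) (supps-cutConfs L (children s))

  supps-cutConfs : ∀ L cs → supps (cutConfs L true cs) ≡ supps (cutConfs L false cs)
  supps-cutConfs L []       = refl
  supps-cutConfs L (c ∷ cs) = cong₂ _∷_ (supp-cutConfAt L c (isCut c)) (supps-cutConfs L cs)

mutual
  depthSet-⊆-cutConfAt : ∀ L s d → subsetB (depthSet L (unfold L s)) (supp (cutConfAt L false s d)) ≡ true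
  depthSet-⊆-cutConfAt zero    s true  = refl
  depthSet-⊆-cutConfAt zero    s false = refl
  depthSet-⊆-cutConfAt (suc L) s true  =
    subst (λ S → subsetsB (depthSets L (map (unfold L) (children s))) S ≡ true)
          (sym (leafConfs-boundary L false (children s))) (subsetsB-refl (depthSets L (map (unfold L) (children s))))
  depthSet-⊆-cutConfAt (suc L) s false = depthSets-⊆-cutConfs L (children s)

  depthSets-⊆-cutConfs : ∀ L cs → subsetsB (depthSets L (map (unfold L) cs)) (supps (cutConfs L false cs)) ≡ true
  depthSets-⊆-cutConfs L []       = refl
  depthSets-⊆-cutConfs L (c ∷ cs) = cong₂ _∧_ (depthSet-⊆-cutConfAt L c (isCut c)) (depthSets-⊆-cutConfs L cs)

mutual
  cutConfAt-agree : ∀ L s d → agreeOff (depthSet L (unfold L s)) (cutConfAt L false s d) (cutConfAt L true s d) ≡ true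
  cutConfAt-agree zero    s true  = refl
  cutConfAt-agree zero    s false = refl
  cutConfAt-agree (suc L) s true  = agreeOffs-refl (depthSets L (map (unfold L) (children s))) (leafConfs L false (children s))
  cutConfAt-agree (suc L) s false = cutConfs-agree L (children s)

  cutConfs-agree : ∀ L cs → agreeOffs (depthSets L (map (unfold L) cs)) (cutConfs L false cs) (cutConfs L true cs) ≡ true
  cutConfs-agree L []       = refl
  cutConfs-agree L (c ∷ cs) = cong₂ _∧_ (cutConfAt-agree L c (isCut c)) (cutConfs-agree L cs)

-- In units of 10⁻⁶: in the high phase p_v ∈ [highFloor s, 1], in the low phase p_v ∈ [0, lowCeiling s];
-- pinned vertices have p_v = 1.
highFloor : State → ℕ
highFloor O   = 753520
highFloor N   = 753520
highFloor E   = 567963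
highFloor W   = 567963
highFloor NN  = 753520
highFloor NNE = 567963
highFloor NEE = 567963
highFloor EES = 0
highFloor ESE = 470971
highFloor SEE = 428623
highFloor EEN = 567963
highFloor NNW = 567963
highFloor NWW = 567963
highFloor WWS = 0
highFloor WSW = 470971
highFloor SWW = 428623
highFloor WWN = 567963

lowCeiling : State → ℕ
lowCeiling O   = 570281
lowCeiling N   = 570281
lowCeiling E   = 429792
lowCeiling W   = 429792
lowCeiling NN  = 570281
lowCeiling NNE = 429792
lowCeiling NEE = 429792
lowCeiling EES = 0
lowCeiling ESE = 429419
lowCeiling SEE = 362229
lowCeiling EEN = 429792
lowCeiling NNW = 429792
lowCeiling NWW = 429792
lowCeiling WWS = 0
lowCeiling WSW = 429419
lowCeiling SWW = 362229
lowCeiling WWN = 429792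

micro : ℕ → Expr
micro n = num (mkℚᵘ (+ n) 999999)

phaseLowerₑ phaseUpperₑ : Bool → State → Bool → Expr
phaseLowerₑ _     s true  = oneₑ
phaseLowerₑ true  s false = micro (highFloor s)
phaseLowerₑ false s false = zeroₑ
phaseUpperₑ _     s true  = oneₑ
phaseUpperₑ true  s false = oneₑ
phaseUpperₑ false s false = micro (lowCeiling s)

phaseLower phaseUpper : Bool → State → ℚ
phaseLower p s = ⟦ phaseLowerₑ p s (isCut s) ⟧
phaseUpper p s = ⟦ phaseUpperₑ p s (isCut s) ⟧

phaseLowerₑ-nonNeg : ∀ p s d → 0ℚ ≤ ⟦ phaseLowerₑ p s d ⟧
phaseLowerₑ-nonNeg _     s true  = <⇒≤ (positive⁻¹ 1ℚ)
phaseLowerₑ-nonNeg true  s false = num-nonNeg (highFloor s) 999999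
phaseLowerₑ-nonNeg false s false = ≤-refl

phaseUpperₑ-nonNeg : ∀ p s d → 0ℚ ≤ ⟦ phaseUpperₑ p s d ⟧
phaseUpperₑ-nonNeg _     s true  = <⇒≤ (positive⁻¹ 1ℚ)
phaseUpperₑ-nonNeg true  s false = <⇒≤ (positive⁻¹ 1ℚ)
phaseUpperₑ-nonNeg false s false = num-nonNeg (lowCeiling s) 999999

phaseStepValid : Bool → State → Bool → Bool
phaseStepValid q s true  = true
phaseStepValid q s false =
  (phaseLowerₑ (not q) s false *ₑ (oneₑ +ₑ λₑ *ₑ prodₑ (λ c → phaseUpperₑ q c (isCut c)) (children s)) ≤ₑ oneₑ) ∧
  (oneₑ ≤ₑ phaseUpperₑ (not q) s false *ₑ (oneₑ +ₑ λₑ *ₑ prodₑ (λ c → phaseLowerₑ q c (isCut c)) (children s)))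

separation : ℚ
separation = + 11 / 100

opaque
  unfolding _≤ₑ_
  phaseSteps-≡ : ∀ q → allStates (λ s → phaseStepValid q s (isCut s)) ≡ true
  phaseSteps-≡ true  = refl
  phaseSteps-≡ false = refl

  highFloors-≡ : allStates (λ s → micro (highFloor s) ≤ₑ oneₑ) ≡ true
  highFloors-≡ = refl

  phases-separated-≡ : (micro (lowCeiling O) +ₑ rat separation ≤ₑ micro (highFloor O)) ≡ true
  phases-separated-≡ = refl

phaseStep-sound : ∀ q s → isCut s ≡ false → T (phaseStepValid q s false)
phaseStep-sound q s isCut≡false =
  subst (T ∘ phaseStepValid q s) isCut≡false (allStates-sound (λ s → phaseStepValid q s (isCut s)) (true⇒T (phaseSteps-≡ q)) s)

highFloor≤1 : ∀ s → ⟦ micro (highFloor s) ⟧ ≤ 1ℚ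
highFloor≤1 s = ≤ₑ-sound _ _ (allStates-sound (λ s → micro (highFloor s) ≤ₑ oneₑ) (true⇒T highFloors-≡) s)

phases-separated : ⟦ micro (lowCeiling O) ⟧ + separation ≤ ⟦ micro (highFloor O) ⟧
phases-separated = ≤ₑ-sound _ _ (true⇒T phases-separated-≡)

-- whether a vertex at height L above leaves fixed to b is in the high phase
parity : ℕ → Bool → Bool
parity zero    b = not b
parity (suc L) b = not (parity L b)

leafConfs-pos : ∀ L cs → 0ℚ < ΠZ λ₀ (map (unfold L) cs) (leafConfs L false cs)
leafConfs-pos L cs = denominator-pos (RatioIn-prod (unfold L) (λ _ → ≤-refl) cs (leafConfs L false cs)
  (RatioBounds⇒AllRatioIn (RatioBounds-unit 0<λ₀ L) cs (leafConfs L false cs) (leafConfs-boundary L false cs)))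

mutual
  cutConfAt-bounds : ∀ L b s d → isCut s ≡ d →
    RatioIn ⟦ phaseLowerₑ (parity L b) s d ⟧ ⟦ phaseUpperₑ (parity L b) s d ⟧ (Zc0 λ₀ (unfold L s) (cutConfAt L b s d)) (Zc λ₀ (unfold L s) (cutConfAt L b s d))
  cutConfAt-bounds zero    b     s true  _ = RatioIn-unoccupied-leaf ≤-refl ≤-refl
  cutConfAt-bounds zero    true  s false _ = RatioIn-occupied-leaf 0<λ₀ ≤-refl (num-nonNeg (lowCeiling s) 999999)
  cutConfAt-bounds zero    false s false _ = RatioIn-unoccupied-leaf (highFloor≤1 s) ≤-refl
  cutConfAt-bounds (suc L) b     s true  _ = RatioIn-unoccupied-root (map (unfold L) (children s)) (leafConfs L false (children s)) (leafConfs-pos L (children s))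
  cutConfAt-bounds (suc L) b     s false e =
    RatioIn-free-root (unfold L) (children s) (cutConfs L b (children s))
      (phaseLowerₑ-nonNeg (not q) s false) (phaseUpperₑ-nonNeg (not q) s false) (λ c → phaseLowerₑ-nonNeg q c (isCut c))
      (subst (λ P → ⟦ phaseLowerₑ (not q) s false ⟧ * (1ℚ + λ₀ * P) ≤ 1ℚ) (⟦prodₑ⟧ (λ c → phaseUpperₑ q c (isCut c)) (children s))
        (≤ₑ-sound _ _ (proj₁ checks)))
      (subst (λ P → 1ℚ ≤ ⟦ phaseUpperₑ (not q) s false ⟧ * (1ℚ + λ₀ * P)) (⟦prodₑ⟧ (λ c → phaseLowerₑ q c (isCut c)) (children s))
        (≤ₑ-sound _ _ (proj₂ checks)))
      (cutConfs-bounds L b (children s))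
    where
    q = parity L b
    checks = T-∧⁻ (phaseLowerₑ (not q) s false *ₑ (oneₑ +ₑ λₑ *ₑ prodₑ (λ c → phaseUpperₑ q c (isCut c)) (children s)) ≤ₑ oneₑ) (phaseStep-sound q s e)

  cutConfs-bounds : ∀ L b cs → AllRatioIn (unfold L) (phaseLower (parity L b)) (phaseUpper (parity L b)) cs (cutConfs L b cs)
  cutConfs-bounds L b []       = tt
  cutConfs-bounds L b (c ∷ cs) = cutConfAt-bounds L b c (isCut c) refl , cutConfs-bounds L b cs

high-phase : ∀ n b → parity n b ≡ true → ⟦ micro (highFloor O) ⟧ ≤ pRoot λ₀ (TD' n) (cutConf n b O)
high-phase n b eq = proj₁ (RatioIn⇒pRoot-bounds (TD' n) (cutConf n b O)
  (subst (λ p → RatioIn ⟦ phaseLowerₑ p O false ⟧ ⟦ phaseUpperₑ p O false ⟧ (Zc0 λ₀ (TD' n) (cutConf n b O)) (Zc λ₀ (TD' n) (cutConf n b O)))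
         eq (cutConfAt-bounds n b O false refl)))

low-phase : ∀ n b → parity n b ≡ false → pRoot λ₀ (TD' n) (cutConf n b O) ≤ ⟦ micro (lowCeiling O) ⟧
low-phase n b eq = proj₂ (RatioIn⇒pRoot-bounds (TD' n) (cutConf n b O)
  (subst (λ p → RatioIn ⟦ phaseLowerₑ p O false ⟧ ⟦ phaseUpperₑ p O false ⟧ (Zc0 λ₀ (TD' n) (cutConf n b O)) (Zc λ₀ (TD' n) (cutConf n b O)))
         eq (cutConfAt-bounds n b O false refl)))

parity-not : ∀ L → parity L true ≡ not (parity L false)
parity-not zero    = refl
parity-not (suc L) = cong not (parity-not L)

phases-apart : ∀ n → let p₁ = pRoot λ₀ (TD' n) (cutConf n false O); p₂ = pRoot λ₀ (TD' n) (cutConf n true O) in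
  separation ≤ p₁ - p₂ ⊎ separation ≤ p₂ - p₁
phases-apart n with parity n false in eq
... | true  = inj₁ (gap≤x-y (high-phase n false eq) (low-phase n true (trans (parity-not n) (cong not eq))) phases-separated)
... | false = inj₂ (gap≤x-y (high-phase n true (trans (parity-not n) (cong not eq))) (low-phase n false eq) phases-separated)

cut-gap : ∀ n → separation ≤ ∣ pRoot λ₀ (TD' n) (cutConf n false O) - pRoot λ₀ (TD' n) (cutConf n true O) ∣
cut-gap n = c≤∣x-y∣ (pRoot λ₀ (TD' n) (cutConf n false O)) (pRoot λ₀ (TD' n) (cutConf n true O)) (phases-apart n)

¬ssm : ¬ SSM λ₀ TD'
¬ssm (γ′ , 0<γ′ , γ′<1 , ssm) = uncurry refute (^ℚ-eventually-< γ′ separation (<⇒≤ 0<γ′) γ′<1 (toWitness {a? = 0ℚ <? separation} tt))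
  where
  strong-mixing : ∀ n → ∣ pRoot λ₀ (TD' n) (cutConf n false O) - pRoot λ₀ (TD' n) (cutConf n true O) ∣ ≤ γ′ ^ℚ n
  strong-mixing n = subst (λ d → ∣ pRoot λ₀ (TD' n) τ₁ - pRoot λ₀ (TD' n) τ₂ ∣ ≤ powDist γ′ d) (distRoot-depthSet n O)
    (ssm n (supp τ₁) (depthSet n (TD' n)) τ₁ τ₂ (depthSet-⊆-cutConfAt n O false) refl (supp-cutConfAt n O false) (cutConfAt-agree n O false)
       (denominator-pos (cutConfAt-bounds n false O false refl)) (denominator-pos (cutConfAt-bounds n true O false refl)))
    where
    τ₁ = cutConf n false O
    τ₂ = cutConf n true O
  refute : ∀ n → γ′ ^ℚ n < separation → ⊥
  refute n γ′ⁿ<separation = <-irrefl refl (<-≤-trans γ′ⁿ<separation (≤-trans (cut-gap n) (strong-mixing n)))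

lemma11 : WSM λ₀ TD' × ¬ SSM λ₀ TD'
lemma11 = wsm , ¬ssm
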